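{- For every $d\in\mathbb{N}$ with $d\ge 2$ there is $\epsilon=\epsilon(d)\in(0,1)$ such that for every $d$-regular graph $\mathcal{E}$ and every linear order $f$ of $E(\vec{\mathcal{E}})$, the graph $G_{\mathcal{E}}$ (which has maximum degree at most $d+3$, regarded as a member of $\mathcal{C}_{d+3}$) is $\epsilon$-far from being Hamiltonian.
   Context: All graphs are finite and simple. $\mathcal{C}_D$ is the class of graphs of maximum degree at most $D$. A graph $G\in\mathcal{C}_D$ is $\epsilon$-far from being Hamiltonian if for every set $E$ of 2-element subsets of $V(G)$ with $|E|\le\epsilon D|V(G)|$ the graph $(V(G),E(G)\triangle E)$ has no Hamiltonian cycle. Construction. For a $d$-regular graph $\mathcal{E}$, let $\vec{\mathcal{E}}$ be the directed graph on $V(\mathcal{E})$ containing both $(u,v)$ and $(v,u)$ for each edge $\{u,v\}\in E(\mathcal{E})$. For vertices $v_1,\dots,v_{31}$, $P(v_1,\dots,v_{31})$ is the graph on these vertices with edges $\{v_i,v_{i+1}\}$ ($1\le i\le 30$), $\{v_2,v_5\},\{v_{27},v_{30}\},\{v_6,v_{11}\},\{v_{12},v_{17}\},\{v_{15},v_{20}\},\{v_{21},v_{26}\}$. A link from $P(u_1,\dots,u_{31})$ to $P(v_1,\dots,v_{31})$ via $w_1,\dots,w_6$ consists of the edges $\{u_{23},v_3\},\{u_{18},v_8\},\{u_{29},v_9\},\{u_{24},v_{14}\},\{v_5,w_1\},\{w_1,w_2\},\{w_2,w_3\},\{w_3,u_{23}\},\{u_{24},w_4\},\{w_4,w_5\},\{w_5,w_6\},\{w_6,v_{12}\}$.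 Let $m=|E(\vec{\mathcal{E}})|$ and $f:E(\vec{\mathcal{E}})\to\{1,\dots,m\}$ a bijection. $G_{\mathcal{E}}$ has pairwise distinct vertices $a^e_1,\dots,a^e_{31}$ for each $e\in E(\vec{\mathcal{E}})$ and $b^v_1,\dots,b^v_6$ for each $v\in V(\mathcal{E})$, and its edge set is exactly the union of: the edges of $P(a^e_1,\dots,a^e_{31})$ for each $e$; the edges $\{a^{f^{ -1}(i)}_{31},a^{f^{ -1}(j)}_1\}$ for $i\in\{1,\dots,m\}$, where $j=i+1$ if $i<m$ and $j=1$ if $i=m$; and, for all vertices $u,v,w$ with $(u,v),(v,w)\in E(\vec{\mathcal{E}})$, the edges of a link from $P(a^{(u,v)}_1,\dots,a^{(u,v)}_{31})$ to $P(a^{(v,w)}_1,\dots,a^{(v,w)}_{31})$ via $b^v_1,\dots,b^v_6$. -}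

module Defs where

open import Data.Nat as ℕ using (ℕ; zero; suc; _∸_)
open import Data.Nat.DivMod using (_%_; m%n<n)
open import Data.Fin as Fin using (Fin; toℕ; fromℕ<; #_)
open import Data.Fin.Properties using (+↔⊎; *↔×)
open import Data.Product using (Σ; Σ-syntax; ∃; ∃-syntax; _×_; _,_; proj₁; proj₂)
open import Data.Sum using (_⊎_; inj₁; inj₂)
open import Data.List using (List; []; _∷_; length; _++_; map; upTo)
open import Data.List.Membership.Propositional using (_∈_)
open import Data.List.Relation.Unary.All using (All)
open import Data.List.Relation.Unary.Unique.Propositional using (Unique)
open import Data.Rational as ℚ using (ℚ; 0ℚ; 1ℚ; _/_)
open import Data.Integer using (+_)
open import Relation.Nullary using (¬_)
open import Relation.Nullary.Decidable using (True; toWitness)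
open import Data.List.Relation.Unary.All using (all?)
import Data.List.Relation.Unary.All.Properties as AllP
open import Data.List.Relation.Unary.Any using (here; there)
open import Data.Nat.Properties using (<-irrefl)
open import Relation.Binary.PropositionalEquality using (refl)
open import Relation.Binary.PropositionalEquality using (_≡_; _≢_)
open import Function using (_⇔_; _↔_)
open import Function.Bundles using (Inverse)
open import Function.Definitions using (Bijective)
open import Function.Properties.Inverse using (↔-sym; ↔-trans)
open import Data.Product.Function.NonDependent.Propositional using (_×-↔_)
open import Data.Sum.Function.Propositional using (_⊎-↔_)
open import Function.Construct.Identity using (↔-id)

record Graph : Set₁ where
  field
    V          : Set
    size       : ℕ
    enum       : V ↔ Fin size
    Adj        : V → V → Set
    Adj-sym    : ∀ {x y} → Adj x y → Adj y x
    Adj-irrefl : ∀ {x} → ¬ Adj x x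

open Graph public

-- The edge relation is proposition-valued (a graph has at most one edge
-- between two vertices; needed so that the arcs of ℰ⃗ are counted correctly).
AdjProp : Graph → Set
AdjProp G = ∀ {x y} (p q : Adj G x y) → p ≡ q

HasDegree : (G : Graph) → V G → ℕ → Set
HasDegree G v d = Σ[ L ∈ List (V G) ] (Unique L × length L ≡ d × (∀ w → Adj G v w ⇔ w ∈ L))

Regular : ℕ → Graph → Set
Regular d G = ∀ v → HasDegree G v d

MaxDegree≤ : ℕ → Graph → Set
MaxDegree≤ D G = ∀ v → Σ[ L ∈ List (V G) ] (length L ℕ.≤ D × (∀ w → Adj G v w → w ∈ L))

next : ∀ {n} → Fin n → Fin n
next {suc k} i = fromℕ< (m%n<n (suc (toℕ i)) (suc k))

HasHamCycle : (V : Set) (n : ℕ) (R : V → V → Set) → Set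
HasHamCycle V n R =
  3 ℕ.≤ n × Σ[ σ ∈ (Fin n → V) ] (Bijective _≡_ _≡_ σ × (∀ i → R (σ i) (σ (next i))))

Hamiltonian : Graph → Set
Hamiltonian G = HasHamCycle (V G) (size G) (Adj G)

-- A set E of 2-element subsets of V(G), given as a list of pairs with
-- distinct entries ({x,y} ∈ E iff (x,y) or (y,x) occurs in the list).
InE : {V : Set} → List (V × V) → V → V → Set
InE E x y = ((x , y) ∈ E) ⊎ ((y , x) ∈ E)

Toggle : (G : Graph) → List (V G × V G) → V G → V G → Set
Toggle G E x y = (Adj G x y × ¬ InE E x y) ⊎ (¬ Adj G x y × InE E x y)

ℕtoℚ : ℕ → ℚ
ℕtoℚ n = (+ n) / 1

EpsFarFromHam : ℚ → ℕ → Graph → Set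
EpsFarFromHam ε D G =
  ∀ (E : List (V G × V G)) →
    All (λ p → proj₁ p ≢ proj₂ p) E →
    ℕtoℚ (length E) ℚ.≤ ε ℚ.* ℕtoℚ D ℚ.* ℕtoℚ (size G) →
    ¬ HasHamCycle (V G) (size G) (Toggle G E)

Arc : Graph → Set
Arc ℰ = Σ[ p ∈ (V ℰ × V ℰ) ] Adj ℰ (proj₁ p) (proj₂ p)

tail head : (ℰ : Graph) → Arc ℰ → V ℰ
tail ℰ ((u , _) , _) = u
head ℰ ((_ , v) , _) = v

-- vertices: a^e_k (e an arc, k = 1..31) and b^v_k (v ∈ V(ℰ), k = 1..6).
-- The Fin index i stands for the subscript toℕ i + 1.
GV : Graph → Set
GV ℰ = (Arc ℰ × Fin 31) ⊎ (V ℰ × Fin 6)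

module _ (ℰ : Graph) where
  a : Arc ℰ → (k : ℕ) → {p : True ((k ∸ 1) ℕ.<? 31)} → GV ℰ
  a e k {p} = inj₁ (e , (#_ (k ∸ 1) {31} {p}))

  b : V ℰ → (k : ℕ) → {p : True ((k ∸ 1) ℕ.<? 6)} → GV ℰ
  b v k {p} = inj₂ (v , (#_ (k ∸ 1) {6} {p}))

lab : Fin 31 → ℕ
lab i = suc (toℕ i)

PEdges : List (ℕ × ℕ)
PEdges = map (λ i → (suc i , suc (suc i))) (upTo 30)
      ++ (2 , 5) ∷ (27 , 30) ∷ (6 , 11) ∷ (12 , 17) ∷ (15 , 20) ∷ (21 , 26) ∷ []

data GEdge (ℰ : Graph) {m : ℕ} (f : Arc ℰ ↔ Fin m) : GV ℰ → GV ℰ → Set where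
  pEdge  : ∀ (e : Arc ℰ) (i j : Fin 31) → (lab i , lab j) ∈ PEdges → GEdge ℰ f (inj₁ (e , i)) (inj₁ (e , j))
  cycEdge : ∀ (i : Fin m) →
    GEdge ℰ f (a ℰ (Inverse.from f i) 31) (a ℰ (Inverse.from f (next i)) 1)
  l1  : ∀ e₁ e₂ → head ℰ e₁ ≡ tail ℰ e₂ → GEdge ℰ f (a ℰ e₁ 23) (a ℰ e₂ 3)
  l2  : ∀ e₁ e₂ → head ℰ e₁ ≡ tail ℰ e₂ → GEdge ℰ f (a ℰ e₁ 18) (a ℰ e₂ 8)
  l3  : ∀ e₁ e₂ → head ℰ e₁ ≡ tail ℰ e₂ → GEdge ℰ f (a ℰ e₁ 29) (a ℰ e₂ 9)
  l4  : ∀ e₁ e₂ → head ℰ e₁ ≡ tail ℰ e₂ → GEdge ℰ f (a ℰ e₁ 24) (a ℰ e₂ 14)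
  l5  : ∀ e₁ e₂ → head ℰ e₁ ≡ tail ℰ e₂ → GEdge ℰ f (a ℰ e₂ 5) (b ℰ (head ℰ e₁) 1)
  l6  : ∀ e₁ e₂ → head ℰ e₁ ≡ tail ℰ e₂ → GEdge ℰ f (b ℰ (head ℰ e₁) 1) (b ℰ (head ℰ e₁) 2)
  l7  : ∀ e₁ e₂ → head ℰ e₁ ≡ tail ℰ e₂ → GEdge ℰ f (b ℰ (head ℰ e₁) 2) (b ℰ (head ℰ e₁) 3)
  l8  : ∀ e₁ e₂ → head ℰ e₁ ≡ tail ℰ e₂ → GEdge ℰ f (b ℰ (head ℰ e₁) 3) (a ℰ e₁ 23)
  l9  : ∀ e₁ e₂ → head ℰ e₁ ≡ tail ℰ e₂ → GEdge ℰ f (a ℰ e₁ 24) (b ℰ (head ℰ e₁) 4)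
  l10 : ∀ e₁ e₂ → head ℰ e₁ ≡ tail ℰ e₂ → GEdge ℰ f (b ℰ (head ℰ e₁) 4) (b ℰ (head ℰ e₁) 5)
  l11 : ∀ e₁ e₂ → head ℰ e₁ ≡ tail ℰ e₂ → GEdge ℰ f (b ℰ (head ℰ e₁) 5) (b ℰ (head ℰ e₁) 6)
  l12 : ∀ e₁ e₂ → head ℰ e₁ ≡ tail ℰ e₂ → GEdge ℰ f (b ℰ (head ℰ e₁) 6) (a ℰ e₂ 12)

GAdj : (ℰ : Graph) {m : ℕ} (f : Arc ℰ ↔ Fin m) → GV ℰ → GV ℰ → Set
GAdj ℰ f x y = GEdge ℰ f x y ⊎ GEdge ℰ f y x

PEdges-< : All (λ p → proj₁ p ℕ.< proj₂ p) PEdges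
PEdges-< = toWitness {a? = all? (λ p → proj₁ p ℕ.<? proj₂ p) PEdges} _

private
  lookupAll : ∀ {A : Set} {P : A → Set} {xs : List A} {x} → All P xs → x ∈ xs → P x
  lookupAll (px All.∷ _) (here refl) = px
  lookupAll (_ All.∷ pxs) (there m) = lookupAll pxs m

GEdge-irrefl : ∀ (ℰ : Graph) {m} (f : Arc ℰ ↔ Fin m) {x} → ¬ GEdge ℰ f x x
GEdge-irrefl ℰ f (pEdge e i .i mem) = <-irrefl refl (lookupAll PEdges-< mem)

G[_,_] : (ℰ : Graph) {m : ℕ} (f : Arc ℰ ↔ Fin m) → Graph
G[_,_] ℰ {m} f = record
  { V = GV ℰ
  ; size = m ℕ.* 31 ℕ.+ size ℰ ℕ.* 6
  ; enum = ↔-trans ((↔-trans (f ×-↔ ↔-id (Fin 31)) (↔-sym *↔×)) ⊎-↔ (↔-trans (enum ℰ ×-↔ ↔-id (Fin 6)) (↔-sym *↔×))) (↔-sym +↔⊎)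
  ; Adj = GAdj ℰ f
  ; Adj-sym = λ { (inj₁ p) → inj₂ p ; (inj₂ p) → inj₁ p }
  ; Adj-irrefl = λ { (inj₁ p) → GEdge-irrefl ℰ f p ; (inj₂ p) → GEdge-irrefl ℰ f p }
  }

-- Suppose an edit set E turns G_ℰ into a graph with a Hamiltonian cycle C, and call a vertex
-- untouched if it lies in no pair of E.  If the whole gadget P(e) of an arc e is untouched, C runs
-- through the P-degree-two vertices a_7, a_10, a_13, a_16, a_19 of P(e) along P, and since C has more
-- than 6 vertices it contains none of the 6-cycles of P; the two cycle edges at each of a_8, a_11,
-- a_12, a_14, a_15, a_17, a_18 then force
--   hub(e) + in14(e) ≤ in8(e)   and   out18(e) ≤ in14(e),
-- where hub, in8, in14 and out18 count the edges of C from a^e_12 to the b_6's, from a^e_8 to the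
-- a_18's, from a^e_14 to the a_24's and from a^e_18 to the a_8's.  Each touch of P(e) costs at most 6.
-- Summed over all arcs the edges between a_8's and a_18's cancel, so at most 6·2|E| edges of C join an
-- a_12 to a b_6; yet every untouched b^v_6 needs one, its only other neighbour being b^v_5.  Hence
-- |V(ℰ)| ≤ 14|E|, while |V(G_ℰ)| ≤ (31d + 6)|V(ℰ)|, so ε = 1/(14(d+3)(31d+6) + 2) works.

module Submission where

open import Data.Empty using (⊥; ⊥-elim)
open import Data.Fin as Fin using (Fin; toℕ; fromℕ; inject₁; combine; cast; #_)
open import Data.Fin.Patterns using (0F; 1F; 2F; 3F; 4F; 5F)
open import Data.Fin.Properties using (toℕ-injective; toℕ-fromℕ<; toℕ-fromℕ; toℕ-inject₁; toℕ<n)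
import Data.Fin.Properties as Finₚ
import Data.Integer as ℤ
import Data.Integer.Properties as ℤₚ
open import Data.List as List using (List; []; _∷_; _++_; map; length; lookup; filter; allFin)
open import Data.List.Membership.Propositional using (_∈_; _∉_; mapWith∈)
open import Data.List.Membership.Propositional.Properties using (∈-map⁺; ∈-map⁻; ∈-++⁺ˡ; ∈-++⁺ʳ; ∈-++⁻; ∈-allFin)
import Data.List.Membership.Setoid.Properties as Membershipₚ
open import Data.List.Properties using (length-map; length-++)
open import Data.List.Relation.Unary.All as All using (All; all?)
open import Data.List.Relation.Unary.All.Properties using (All¬⇒¬Any)
import Data.List.Relation.Unary.AllPairs as AllPairs
open import Data.List.Relation.Unary.Any using (here; there; index)
open import Data.List.Relation.Unary.Any.Properties using (lookup-index)
open import Data.List.Relation.Unary.Unique.Propositional using (Unique)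
open import Data.Nat as ℕ using (ℕ; zero; suc; _+_; _*_; _∸_; _≤_; _>_; z≤n; s≤s)
open import Data.Nat.DivMod using (_%_; _/_; m%n<n; m<n⇒m%n≡m; n%n≡0; %-distribˡ-+; m%n%n≡m%n; m≡m%n+[m/n]*n)
open import Data.Nat.Properties hiding (_≟_)
open import Data.Nat.Solver using (module +-*-Solver)
open import Data.Product using (Σ-syntax; ∃; _×_; _,_; proj₁; proj₂)
import Data.Product.Properties as Σₚ
open import Data.Rational as ℚ using (ℚ; 0ℚ; 1ℚ; _<_; toℚᵘ)
import Data.Rational.Properties as ℚₚ
open import Data.Rational.Unnormalised as ℚᵘ using (mkℚᵘ; *≤*; *<*)
import Data.Rational.Unnormalised.Properties as ℚᵘₚ
open import Data.Sum using (_⊎_; inj₁; inj₂)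
import Data.Sum.Properties as ⊎ₚ
import Data.Vec as Vec
open import Data.Vec.Functional using (Vector) renaming ([] to []ᵥ; _∷_ to _∷ᵥ_)
open import Function using (_∘_; _↔_; _⇔_)
open import Function.Bundles using (Inverse; Injection; Equivalence)
open import Function.Properties.Inverse using (↔⇒↣; ↔-sym)
open import Function.Definitions using (Injective; Bijective)
open import Relation.Binary.Definitions using (DecidableEquality; Symmetric)
open import Relation.Binary.PropositionalEquality
open import Relation.Nullary using (¬_; Dec; yes; no)
open import Relation.Nullary.Decidable using (True; toWitness; via-injection; _→-dec_; _×-dec_)

open import Algebra.Properties.Semiring.Sum +-*-semiring using (sum; sum-cong-≗; ∑-distrib-+; ∑-comm; *-distribˡ-sum)
open import Data.List.Membership.DecPropositional (Σₚ.≡-dec ℕ._≟_ ℕ._≟_) using (_∈?_)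
open import Data.List.Membership.DecPropositional (Fin._≟_ {31}) using (_∉?_) renaming (_∈?_ to _∈?ᶠ_)
open import Data.List.Relation.Unary.Unique.DecPropositional (Fin._≟_ {31}) using (unique?)
open +-*-Solver using (solve; _:+_; _:*_; _:=_; con)

open import Defs

-- Finite sums and counting

𝟙 : {P : Set} → Dec P → ℕ
𝟙 (yes _) = 1
𝟙 (no _)  = 0

𝟙-yes : {P : Set} (p? : Dec P) → P → 𝟙 p? ≡ 1
𝟙-yes (yes _) _ = refl
𝟙-yes (no ¬p) p = ⊥-elim (¬p p)

𝟙-no : {P : Set} (p? : Dec P) → ¬ P → 𝟙 p? ≡ 0
𝟙-no (yes p) ¬p = ⊥-elim (¬p p)
𝟙-no (no _)  _  = refl

𝟙-cong : {P Q : Set} (p? : Dec P) (q? : Dec Q) → (P → Q) → (Q → P) → 𝟙 p? ≡ 𝟙 q?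
𝟙-cong (yes p) q? to from = sym (𝟙-yes q? (to p))
𝟙-cong (no ¬p) q? to from = sym (𝟙-no q? (¬p ∘ from))

sum-mono-≤ : ∀ {n} {g h : Fin n → ℕ} → (∀ i → g i ≤ h i) → sum g ≤ sum h
sum-mono-≤ {zero}  g≤h = z≤n
sum-mono-≤ {suc n} g≤h = +-mono-≤ (g≤h Fin.zero) (sum-mono-≤ (g≤h ∘ Fin.suc))

sum-const : ∀ n c → sum {n} (λ _ → c) ≡ n * c
sum-const zero    c = refl
sum-const (suc n) c = cong (c +_) (sum-const n c)

sum-zero : ∀ {n} (g : Fin n → ℕ) → (∀ i → g i ≡ 0) → sum g ≡ 0
sum-zero {n} g g≡0 = trans (sum-cong-≗ g≡0) (trans (sum-const n 0) (*-zeroʳ n))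

sum≡0⇒≡0 : ∀ {n} (g : Fin n → ℕ) → sum g ≡ 0 → ∀ i → g i ≡ 0
sum≡0⇒≡0 g Σ≡0 Fin.zero    = m+n≡0⇒m≡0 (g Fin.zero) Σ≡0
sum≡0⇒≡0 g Σ≡0 (Fin.suc i) = sum≡0⇒≡0 (g ∘ Fin.suc) (m+n≡0⇒n≡0 (g Fin.zero) Σ≡0) i

module Count {X : Set} (_≟_ : DecidableEquality X) where

  count : ∀ {n} → (Fin n → X) → X → ℕ
  count h z = sum (λ i → 𝟙 (h i ≟ z))

  count-miss : ∀ {n} (h : Fin n → X) z → (∀ i → h i ≢ z) → count h z ≡ 0
  count-miss h z miss = sum-zero _ (λ i → 𝟙-no (h i ≟ z) (miss i))

  count-injective-≤1 : ∀ {n} (h : Fin n → X) → Injective _≡_ _≡_ h → ∀ z → count h z ≤ 1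
  count-injective-≤1 {zero}  h inj z = z≤n
  count-injective-≤1 {suc n} h inj z with h Fin.zero ≟ z
  ... | yes h0≡z = ≤-reflexive (cong suc (count-miss (h ∘ Fin.suc) z
                                            (λ i hi≡z → Finₚ.0≢1+n (inj (trans h0≡z (sym hi≡z))))))
  ... | no _ = count-injective-≤1 (h ∘ Fin.suc) (Finₚ.suc-injective ∘ inj) z

  count-hit : ∀ {n} (h : Fin n → X) {i z} → h i ≡ z → 1 ≤ count h z
  count-hit h {Fin.zero} {z} h0≡z with h Fin.zero ≟ z
  ... | yes _    = s≤s z≤n
  ... | no  h0≢z = ⊥-elim (h0≢z h0≡z)
  count-hit h {Fin.suc i} hi≡z = ≤-trans (count-hit (h ∘ Fin.suc) hi≡z) (m≤n+m _ _)

  count-injective-≡1 : ∀ {n} (h : Fin n → X) → Injective _≡_ _≡_ h → ∀ {i z} → h i ≡ z → count h z ≡ 1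
  count-injective-≡1 h inj {z = z} hi≡z = ≤-antisym (count-injective-≤1 h inj z) (count-hit h hi≡z)

-- The cyclic successor on Fin n

toℕ-next : ∀ {n} (i : Fin (suc n)) → toℕ (next i) ≡ suc (toℕ i) % suc n
toℕ-next {n} i = toℕ-fromℕ< (m%n<n (suc (toℕ i)) (suc n))

prev : ∀ {n} → Fin n → Fin n
prev {suc n} Fin.zero    = fromℕ n
prev {suc n} (Fin.suc i) = inject₁ i

next-prev : ∀ {n} (i : Fin n) → next (prev i) ≡ i
next-prev {suc n} Fin.zero = toℕ-injective (begin
  toℕ (next (fromℕ n))       ≡⟨ toℕ-next (fromℕ n) ⟩
  suc (toℕ (fromℕ n)) % suc n ≡⟨ cong (λ x → suc x % suc n) (toℕ-fromℕ n) ⟩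
  suc n % suc n              ≡⟨ n%n≡0 (suc n) ⟩
  0                          ∎)
  where open ≡-Reasoning
next-prev {suc n} (Fin.suc i) = toℕ-injective (begin
  toℕ (next (inject₁ i))       ≡⟨ toℕ-next (inject₁ i) ⟩
  suc (toℕ (inject₁ i)) % suc n ≡⟨ cong (λ x → suc x % suc n) (toℕ-inject₁ i) ⟩
  suc (toℕ i) % suc n          ≡⟨ m<n⇒m%n≡m (s≤s (toℕ<n i)) ⟩
  suc (toℕ i)                  ∎)
  where open ≡-Reasoning

next-cases : ∀ {n} (i : Fin (suc n)) →
  (toℕ (next i) ≡ suc (toℕ i)) ⊎ (suc (toℕ i) ≡ suc n × toℕ (next i) ≡ 0)
next-cases {n} i with m≤n⇒m<n∨m≡n (toℕ<n i)
... | inj₁ lt = inj₁ (trans (toℕ-next i) (m<n⇒m%n≡m lt))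
... | inj₂ eq = inj₂ (eq , trans (toℕ-next i) (trans (cong (_% suc n) eq) (n%n≡0 (suc n))))

next-injective : ∀ {n} {i j : Fin n} → next i ≡ next j → i ≡ j
next-injective {suc n} {i} {j} eq with next-cases i | next-cases j
... | inj₁ p       | inj₁ q       = toℕ-injective (suc-injective (trans (sym p) (trans (cong toℕ eq) q)))
... | inj₂ (p , _) | inj₂ (q , _) = toℕ-injective (suc-injective (trans p (sym q)))
... | inj₁ p       | inj₂ (_ , q) with () ← trans (sym p) (trans (cong toℕ eq) q)
... | inj₂ (_ , p) | inj₁ q       with () ← trans (sym q) (trans (cong toℕ (sym eq)) p)

prev-next : ∀ {n} (i : Fin n) → prev (next i) ≡ i
prev-next i = next-injective (next-prev (next i))

next^ : ∀ {n} → ℕ → Fin n → Fin n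
next^ zero    i = i
next^ (suc k) i = next (next^ k i)

toℕ-next^ : ∀ {n} k (i : Fin (suc n)) → toℕ (next^ k i) ≡ (toℕ i + k) % suc n
toℕ-next^ {n} zero i = sym (trans (cong (_% suc n) (+-identityʳ (toℕ i))) (m<n⇒m%n≡m (toℕ<n i)))
toℕ-next^ {n} (suc k) i = begin
  toℕ (next (next^ k i))                ≡⟨ toℕ-next (next^ k i) ⟩
  suc (toℕ (next^ k i)) % suc n         ≡⟨ cong (λ x → suc x % suc n) (toℕ-next^ k i) ⟩
  (1 + (toℕ i + k) % suc n) % suc n     ≡⟨ %-distribˡ-+ 1 _ (suc n) ⟩
  (1 % suc n + (toℕ i + k) % suc n % suc n) % suc n
    ≡⟨ cong (λ x → (1 % suc n + x) % suc n) (m%n%n≡m%n (toℕ i + k) (suc n)) ⟩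
  (1 % suc n + (toℕ i + k) % suc n) % suc n ≡⟨ sym (%-distribˡ-+ 1 (toℕ i + k) (suc n)) ⟩
  (1 + (toℕ i + k)) % suc n             ≡⟨ cong (_% suc n) (sym (+-suc (toℕ i) k)) ⟩
  (toℕ i + suc k) % suc n               ∎
  where open ≡-Reasoning

-- (t + k) % n ≡ t forces k to be a multiple of n.
next^-aperiodic : ∀ {n} k (i : Fin n) → k > 0 → n > k → next^ k i ≢ i
next^-aperiodic {suc n} k i k>0 n>k loop = k≢q*n (+-cancelˡ-≡ t k (q * suc n) t+k≡t+q*n)
  where
  open ≡-Reasoning
  t = toℕ i
  q = (t + k) / suc n
  t+k≡t+q*n : t + k ≡ t + q * suc n
  t+k≡t+q*n = begin
    t + k                          ≡⟨ m≡m%n+[m/n]*n (t + k) (suc n) ⟩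
    (t + k) % suc n + q * suc n    ≡⟨ cong (_+ q * suc n) (trans (sym (toℕ-next^ k i)) (cong toℕ loop)) ⟩
    t + q * suc n                  ∎
  k≢q*n : k ≢ q * suc n
  k≢q*n k≡ with q
  ... | zero   = <-irrefl (sym k≡) k>0
  ... | suc q' = <-irrefl refl (<-≤-trans n>k (subst (suc n ≤_) (sym k≡) (m≤m+n (suc n) (q' * suc n))))

module HamiltonianCycle {X : Set} (_≟_ : DecidableEquality X) {n : ℕ}
  (σ : Fin n → X) (σ-bijective : Bijective _≡_ _≡_ σ)
  (R : X → X → Set) (R-sym : Symmetric R) (σ-adj : ∀ i → R (σ i) (σ (next i)))
  (3≤n : 3 ≤ n) where

  position : X → Fin n
  position x = proj₁ (proj₂ σ-bijective x)

  σ-position : ∀ x → σ (position x) ≡ x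
  σ-position x = proj₂ (proj₂ σ-bijective x) refl

  position-σ : ∀ i → position (σ i) ≡ i
  position-σ i = proj₁ σ-bijective (σ-position (σ i))

  succ pred : X → X
  succ x = σ (next (position x))
  pred x = σ (prev (position x))

  R-succ : ∀ x → R x (succ x)
  R-succ x = subst (λ z → R z (succ x)) (σ-position x) (σ-adj (position x))

  R-pred : ∀ x → R x (pred x)
  R-pred x = R-sym (subst (R (pred x)) (trans (cong σ (next-prev (position x))) (σ-position x))
                          (σ-adj (prev (position x))))

  position-succ : ∀ {x y} → succ x ≡ y → position y ≡ next (position x)
  position-succ {x} refl = position-σ (next (position x))

  succ⇒pred : ∀ {x y} → succ x ≡ y → pred y ≡ x
  succ⇒pred {x} refl = begin
    σ (prev (position (σ (next (position x))))) ≡⟨ cong (σ ∘ prev) (position-σ _) ⟩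
    σ (prev (next (position x)))                 ≡⟨ cong σ (prev-next (position x)) ⟩
    σ (position x)                               ≡⟨ σ-position x ⟩
    x                                            ∎
    where open ≡-Reasoning

  pred⇒succ : ∀ {x y} → pred x ≡ y → succ y ≡ x
  pred⇒succ {x} refl = begin
    σ (next (position (σ (prev (position x))))) ≡⟨ cong (σ ∘ next) (position-σ _) ⟩
    σ (next (prev (position x)))                 ≡⟨ cong σ (next-prev (position x)) ⟩
    σ (position x)                               ≡⟨ σ-position x ⟩
    x                                            ∎
    where open ≡-Reasoning

  succ≢pred : ∀ x → succ x ≢ pred x
  succ≢pred x eq = next^-aperiodic 2 (position x) (s≤s z≤n) 3≤n
    (trans (cong next (proj₁ σ-bijective eq)) (next-prev (position x)))

  open Count _≟_

  opaque
    cycleEdge : X → X → ℕ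
    cycleEdge x y = 𝟙 (y ≟ succ x) + 𝟙 (y ≟ pred x)

    cycleEdge-sym : ∀ x y → cycleEdge x y ≡ cycleEdge y x
    cycleEdge-sym x y = trans
      (cong₂ _+_ (𝟙-cong (y ≟ succ x) (x ≟ pred y) (sym ∘ succ⇒pred ∘ sym) (sym ∘ pred⇒succ ∘ sym))
                 (𝟙-cong (y ≟ pred x) (x ≟ succ y) (sym ∘ pred⇒succ ∘ sym) (sym ∘ succ⇒pred ∘ sym)))
      (+-comm (𝟙 (x ≟ pred y)) (𝟙 (x ≟ succ y)))

    cycleEdge-≤1 : ∀ x y → cycleEdge x y ≤ 1
    cycleEdge-≤1 x y with y ≟ succ x | y ≟ pred x
    ... | yes y≡s | yes y≡p = ⊥-elim (succ≢pred x (trans (sym y≡s) y≡p))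
    ... | yes _   | no _    = ≤-refl
    ... | no _    | yes _   = ≤-refl
    ... | no _    | no _    = z≤n

    cycleEdge≡1 : ∀ x y → cycleEdge x y ≡ 1 → succ x ≡ y ⊎ pred x ≡ y
    cycleEdge≡1 x y e with y ≟ succ x | y ≟ pred x
    ... | yes y≡s | _       = inj₁ (sym y≡s)
    ... | no _    | yes y≡p = inj₂ (sym y≡p)
    ... | no _    | no _    with () ← e

    cycleDegree-≤2 : ∀ {k} x (g : Fin k → X) → Injective _≡_ _≡_ g → sum (λ i → cycleEdge x (g i)) ≤ 2
    cycleDegree-≤2 x g inj = begin
      sum (λ i → cycleEdge x (g i))
        ≡⟨ ∑-distrib-+ (λ i → 𝟙 (g i ≟ succ x)) (λ i → 𝟙 (g i ≟ pred x)) ⟩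
      count g (succ x) + count g (pred x)
        ≤⟨ +-mono-≤ (count-injective-≤1 g inj (succ x)) (count-injective-≤1 g inj (pred x)) ⟩
      2 ∎
      where open ≤-Reasoning

    cycleDegree-≡2 : ∀ {k} x (g : Fin k → X) → Injective _≡_ _≡_ g →
      (∃ λ i → g i ≡ succ x) → (∃ λ j → g j ≡ pred x) → sum (λ i → cycleEdge x (g i)) ≡ 2
    cycleDegree-≡2 x g inj (_ , gi≡s) (_ , gj≡p) = begin
      sum (λ i → cycleEdge x (g i))
        ≡⟨ ∑-distrib-+ (λ i → 𝟙 (g i ≟ succ x)) (λ i → 𝟙 (g i ≟ pred x)) ⟩
      count g (succ x) + count g (pred x)
        ≡⟨ cong₂ _+_ (count-injective-≡1 g inj gi≡s) (count-injective-≡1 g inj gj≡p) ⟩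
      2 ∎
      where open ≡-Reasoning

  continue : ∀ {x y z} → succ x ≡ y → cycleEdge y z ≡ 1 → x ≢ z → succ y ≡ z
  continue sx≡y e x≢z with cycleEdge≡1 _ _ e
  ... | inj₁ sy≡z = sy≡z
  ... | inj₂ py≡z = ⊥-elim (x≢z (trans (sym (succ⇒pred sx≡y)) py≡z))

  private
    no-forward-hexagon : n > 6 → ∀ {x₀ x₁ x₂ x₃ x₄ x₅} →
      succ x₀ ≡ x₁ → cycleEdge x₁ x₂ ≡ 1 → cycleEdge x₂ x₃ ≡ 1 → cycleEdge x₃ x₄ ≡ 1 →
      cycleEdge x₄ x₅ ≡ 1 → cycleEdge x₅ x₀ ≡ 1 →
      x₀ ≢ x₂ → x₁ ≢ x₃ → x₂ ≢ x₄ → x₃ ≢ x₅ → x₄ ≢ x₀ → ⊥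
    no-forward-hexagon n>6 s₀ e₁ e₂ e₃ e₄ e₅ d₀ d₁ d₂ d₃ d₄ =
      next^-aperiodic 6 _ (s≤s z≤n) n>6 (sym loop)
      where
      s₁ = continue s₀ e₁ d₀
      s₂ = continue s₁ e₂ d₁
      s₃ = continue s₂ e₃ d₂
      s₄ = continue s₃ e₄ d₃
      s₅ = continue s₄ e₅ d₄
      loop = trans (position-succ s₅) (cong next (trans (position-succ s₄) (cong next
               (trans (position-succ s₃) (cong next (trans (position-succ s₂) (cong next
               (trans (position-succ s₁) (cong next (position-succ s₀))))))))))

  -- A closed walk of length 6 along cycle edges that never turns back would go
  -- once around the whole cycle.
  no-hexagon : n > 6 → ∀ {x₀ x₁ x₂ x₃ x₄ x₅} →
    cycleEdge x₀ x₁ ≡ 1 → cycleEdge x₁ x₂ ≡ 1 → cycleEdge x₂ x₃ ≡ 1 →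
    cycleEdge x₃ x₄ ≡ 1 → cycleEdge x₄ x₅ ≡ 1 → cycleEdge x₅ x₀ ≡ 1 →
    x₀ ≢ x₂ → x₁ ≢ x₃ → x₂ ≢ x₄ → x₃ ≢ x₅ → x₄ ≢ x₀ → x₅ ≢ x₁ → ⊥
  no-hexagon n>6 {x₀} {x₁} {x₂} {x₃} {x₄} {x₅} e₀ e₁ e₂ e₃ e₄ e₅ d₀ d₁ d₂ d₃ d₄ d₅
    with cycleEdge≡1 x₀ x₁ e₀ | cycleEdge≡1 x₀ x₅ (trans (cycleEdge-sym x₀ x₅) e₅)
  ... | inj₁ s₀ | _ = no-forward-hexagon n>6 s₀ e₁ e₂ e₃ e₄ e₅ d₀ d₁ d₂ d₃ d₄
  ... | inj₂ p₀ | inj₂ p₀' = d₅ (trans (sym p₀') p₀)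
  ... | inj₂ _  | inj₁ s₀ = no-forward-hexagon n>6 s₀ (rev e₄) (rev e₃) (rev e₂) (rev e₁) (rev e₀)
                              (≢-sym d₄) (≢-sym d₃) (≢-sym d₂) (≢-sym d₁) (≢-sym d₀)
    where rev : ∀ {x y} → cycleEdge x y ≡ 1 → cycleEdge y x ≡ 1
          rev {x} {y} e = trans (cycleEdge-sym y x) e

  cycleDegree : ∀ {k} → X → (Fin k → X) → ℕ
  cycleDegree x g = sum (λ i → cycleEdge x (g i))

module Edits {V : Set} (_≟_ : DecidableEquality V) (E : List (V × V)) where

  open Count _≟_

  fst snd : Fin (length E) → V
  fst = proj₁ ∘ lookup E
  snd = proj₂ ∘ lookup E

  opaque
    touches : V → ℕ
    touches x = sum (λ p → 𝟙 (x ≟ fst p) + 𝟙 (x ≟ snd p))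

    untouched-∉ : ∀ {x y} → touches x ≡ 0 → ¬ InE E x y
    untouched-∉ {x} t≡0 (inj₁ xy∈E) = 1+n≢0 (begin
      1                        ≡⟨ sym (𝟙-yes (x ≟ _) (cong proj₁ (lookup-index xy∈E))) ⟩
      𝟙 (x ≟ fst (index xy∈E)) ≡⟨ m+n≡0⇒m≡0 _ (sum≡0⇒≡0 _ t≡0 (index xy∈E)) ⟩
      0                        ∎)
      where open ≡-Reasoning
    untouched-∉ {x} t≡0 (inj₂ yx∈E) = 1+n≢0 (begin
      1                        ≡⟨ sym (𝟙-yes (x ≟ _) (cong proj₂ (lookup-index yx∈E))) ⟩
      𝟙 (x ≟ snd (index yx∈E)) ≡⟨ m+n≡0⇒n≡0 _ (sum≡0⇒≡0 _ t≡0 (index yx∈E)) ⟩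
      0                        ∎)
      where open ≡-Reasoning

    ∑-touches : ∀ {k} (g : Fin k → V) → sum (touches ∘ g) ≡ sum (λ p → count g (fst p) + count g (snd p))
    ∑-touches g = trans (∑-comm (λ i p → 𝟙 (g i ≟ fst p) + 𝟙 (g i ≟ snd p)))
                        (sum-cong-≗ {length E} (λ p → ∑-distrib-+ (λ i → 𝟙 (g i ≟ fst p)) (λ i → 𝟙 (g i ≟ snd p))))

  ∑-touches-≤ : ∀ {k} (g : Fin k → V) → (∀ z → count g z ≤ 1) → sum (touches ∘ g) ≤ 2 * length E
  ∑-touches-≤ g once = begin
    sum (touches ∘ g)                            ≡⟨ ∑-touches g ⟩
    sum (λ p → count g (fst p) + count g (snd p)) ≤⟨ sum-mono-≤ {length E} (λ p → +-mono-≤ (once (fst p)) (once (snd p))) ⟩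
    sum {length E} (λ _ → 2)                     ≡⟨ trans (sum-const (length E) 2) (*-comm (length E) 2) ⟩
    2 * length E                                 ∎
    where open ≤-Reasoning

  ∑∑-touches-≤ : ∀ {k l} (g : Fin k → Fin l → V) → (∀ z → sum (λ i → count (g i) z) ≤ 1) →
    sum (λ i → sum (touches ∘ g i)) ≤ 2 * length E
  ∑∑-touches-≤ {k} g once = begin
    sum (λ i → sum (touches ∘ g i))         ≡⟨ sum-cong-≗ {k} (λ i → ∑-touches (g i)) ⟩
    sum (λ i → sum (λ p → count (g i) (fst p) + count (g i) (snd p)))
                                            ≡⟨ ∑-comm (λ i p → count (g i) (fst p) + count (g i) (snd p)) ⟩
    sum (λ p → sum (λ i → count (g i) (fst p) + count (g i) (snd p)))
                                            ≡⟨ sum-cong-≗ {length E} (λ p → ∑-distrib-+ (λ i → count (g i) (fst p))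
                                                                                       (λ i → count (g i) (snd p))) ⟩
    sum (λ p → sum (λ i → count (g i) (fst p)) + sum (λ i → count (g i) (snd p)))
                                            ≤⟨ sum-mono-≤ {length E} (λ p → +-mono-≤ (once (fst p)) (once (snd p))) ⟩
    sum {length E} (λ _ → 2)               ≡⟨ trans (sum-const (length E) 2) (*-comm (length E) 2) ⟩
    2 * length E                            ∎
    where open ≤-Reasoning

module EditedHamiltonianCycle (G : Graph) (_≟_ : DecidableEquality (V G)) (E : List (V G × V G))
  (σ : Fin (size G) → V G) (σ-bijective : Bijective _≡_ _≡_ σ)
  (σ-adj : ∀ i → Toggle G E (σ i) (σ (next i))) (3≤n : 3 ≤ size G) where

  InE-sym : Symmetric (InE E)
  InE-sym (inj₁ xy∈E) = inj₂ xy∈E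
  InE-sym (inj₂ yx∈E) = inj₁ yx∈E

  Toggle-sym : Symmetric (Toggle G E)
  Toggle-sym (inj₁ (xy , xy∉E)) = inj₁ (Adj-sym G xy , xy∉E ∘ InE-sym)
  Toggle-sym (inj₂ (¬xy , xy∈E)) = inj₂ (¬xy ∘ Adj-sym G , InE-sym xy∈E)

  open HamiltonianCycle _≟_ σ σ-bijective (Toggle G E) Toggle-sym σ-adj 3≤n public
  open Edits _≟_ E public

  untouched-Toggle⇒Adj : ∀ {x y} → touches x ≡ 0 → Toggle G E x y → Adj G x y
  untouched-Toggle⇒Adj t≡0 (inj₁ (xy , _))    = xy
  untouched-Toggle⇒Adj t≡0 (inj₂ (_ , xy∈E)) = ⊥-elim (untouched-∉ t≡0 xy∈E)

  -- An untouched vertex keeps both its cycle edges inside G.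
  cycleDegree-untouched : ∀ {k} x (g : Fin k → V G) → touches x ≡ 0 → Injective _≡_ _≡_ g →
    (∀ {z} → Adj G x z → ∃ λ i → g i ≡ z) → cycleDegree x g ≡ 2
  cycleDegree-untouched x g t≡0 inj covers = cycleDegree-≡2 x g inj
    (covers (untouched-Toggle⇒Adj t≡0 (R-succ x))) (covers (untouched-Toggle⇒Adj t≡0 (R-pred x)))

module _ {A : Set} {n : ℕ} (I : A ↔ Fin n) where

  to-injective : Injective _≡_ _≡_ (Inverse.to I)
  to-injective = Injection.injective (↔⇒↣ I)

  from-injective : Injective _≡_ _≡_ (Inverse.from I)
  from-injective = Injection.injective (↔⇒↣ (↔-sym I))

  ≟-via-↔ : DecidableEquality A
  ≟-via-↔ = via-injection (↔⇒↣ I) Fin._≟_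

∷-injective : ∀ {A : Set} {k} {x : A} {xs : Vector A k} →
  (∀ i → xs i ≢ x) → Injective _≡_ _≡_ xs → Injective _≡_ _≡_ (x ∷ᵥ xs)
∷-injective fresh inj {Fin.zero}  {Fin.zero}  _  = refl
∷-injective fresh inj {Fin.zero}  {Fin.suc j} eq = ⊥-elim (fresh j (sym eq))
∷-injective fresh inj {Fin.suc i} {Fin.zero}  eq = ⊥-elim (fresh i eq)
∷-injective fresh inj {Fin.suc i} {Fin.suc j} eq = cong Fin.suc (inj eq)

∈-mapWith∈ : ∀ {A B : Set} (xs : List A) (g : ∀ {x} → x ∈ xs → B) {x} (x∈ : x ∈ xs) → g x∈ ∈ mapWith∈ xs g
∈-mapWith∈ (x ∷ xs) g (here refl) = here refl
∈-mapWith∈ (x ∷ xs) g (there x∈) = there (∈-mapWith∈ xs (g ∘ there) x∈)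

[]-injective : ∀ {A : Set} → Injective _≡_ _≡_ ([]ᵥ {A = A})
[]-injective {x = ()}

index-injective : ∀ {A : Set} {x y : A} {xs} (p : x ∈ xs) (q : y ∈ xs) → index p ≡ index q → x ≡ y
index-injective {xs = xs} p q eq = trans (lookup-index p) (trans (cong (lookup xs) eq) (sym (lookup-index q)))

cast-injective : ∀ {k l} (k≡l : k ≡ l) {i j : Fin k} → cast k≡l i ≡ cast k≡l j → i ≡ j
cast-injective k≡l eq =
  Finₚ.toℕ-injective (trans (sym (Finₚ.toℕ-cast k≡l _)) (trans (cong toℕ eq) (Finₚ.toℕ-cast k≡l _)))

-- The gadget P and the neighbourhoods in G_ℰ

ix : ∀ {k} (n : ℕ) → {True ((n ∸ 1) ℕ.<? k)} → Fin k
ix {k} n {p} = #_ (n ∸ 1) {k} {p}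

PNbrs : Fin 31 → List (Fin 31)
PNbrs = List.lookup
  ( (ix 2 ∷ [])
  ∷ (ix 1 ∷ ix 3 ∷ ix 5 ∷ [])
  ∷ (ix 2 ∷ ix 4 ∷ [])
  ∷ (ix 3 ∷ ix 5 ∷ [])
  ∷ (ix 2 ∷ ix 4 ∷ ix 6 ∷ [])
  ∷ (ix 5 ∷ ix 7 ∷ ix 11 ∷ [])
  ∷ (ix 6 ∷ ix 8 ∷ [])
  ∷ (ix 7 ∷ ix 9 ∷ [])
  ∷ (ix 8 ∷ ix 10 ∷ [])
  ∷ (ix 9 ∷ ix 11 ∷ [])
  ∷ (ix 6 ∷ ix 10 ∷ ix 12 ∷ [])
  ∷ (ix 11 ∷ ix 13 ∷ ix 17 ∷ [])
  ∷ (ix 12 ∷ ix 14 ∷ [])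
  ∷ (ix 13 ∷ ix 15 ∷ [])
  ∷ (ix 14 ∷ ix 16 ∷ ix 20 ∷ [])
  ∷ (ix 15 ∷ ix 17 ∷ [])
  ∷ (ix 12 ∷ ix 16 ∷ ix 18 ∷ [])
  ∷ (ix 17 ∷ ix 19 ∷ [])
  ∷ (ix 18 ∷ ix 20 ∷ [])
  ∷ (ix 15 ∷ ix 19 ∷ ix 21 ∷ [])
  ∷ (ix 20 ∷ ix 22 ∷ ix 26 ∷ [])
  ∷ (ix 21 ∷ ix 23 ∷ [])
  ∷ (ix 22 ∷ ix 24 ∷ [])
  ∷ (ix 23 ∷ ix 25 ∷ [])
  ∷ (ix 24 ∷ ix 26 ∷ [])
  ∷ (ix 21 ∷ ix 25 ∷ ix 27 ∷ [])
  ∷ (ix 26 ∷ ix 28 ∷ ix 30 ∷ [])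
  ∷ (ix 27 ∷ ix 29 ∷ [])
  ∷ (ix 28 ∷ ix 30 ∷ [])
  ∷ (ix 27 ∷ ix 29 ∷ ix 31 ∷ [])
  ∷ (ix 30 ∷ [])
  ∷ [])

PNbrs-complete : All (λ i → All (λ j → (lab i , lab j) ∈ PEdges → j ∈ PNbrs i × i ∈ PNbrs j) (allFin 31)) (allFin 31)
PNbrs-complete = toWitness {a? = all? (λ i → all? (λ j →
  ((lab i , lab j) ∈? PEdges) →-dec ((j ∈?ᶠ PNbrs i) ×-dec (i ∈?ᶠ PNbrs j))) (allFin 31)) (allFin 31)} _

PNbrs-unique : All (Unique ∘ PNbrs) (allFin 31)
PNbrs-unique = toWitness {a? = all? (unique? ∘ PNbrs) (allFin 31)} _

PEdge⇒PNbrs : ∀ {i j} → (lab i , lab j) ∈ PEdges → j ∈ PNbrs i × i ∈ PNbrs j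
PEdge⇒PNbrs {i} {j} = All.lookup (All.lookup PNbrs-complete (∈-allFin i)) (∈-allFin j)

-- The neighbours of a^e_k outside P(e), through the cycle of all P's or through links, come in the
-- kinds below; ports k lists the kinds that occur at a^e_k.
data Port : Set where
  prevCycle nextCycle : Port
  inTail outHead      : Fin 31 → Port
  tailHub headHub     : Fin 6 → Port

portTable : List (Fin 31 × Port)
portTable =
    (ix 1  , prevCycle)       ∷ (ix 31 , nextCycle)
  ∷ (ix 23 , outHead (ix 3))  ∷ (ix 3  , inTail (ix 23))
  ∷ (ix 18 , outHead (ix 8))  ∷ (ix 8  , inTail (ix 18))
  ∷ (ix 29 , outHead (ix 9))  ∷ (ix 9  , inTail (ix 29))
  ∷ (ix 24 , outHead (ix 14)) ∷ (ix 14 , inTail (ix 24))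
  ∷ (ix 5  , tailHub (ix 1))  ∷ (ix 23 , headHub (ix 3))
  ∷ (ix 24 , headHub (ix 4))  ∷ (ix 12 , tailHub (ix 6)) ∷ []

-- Stored as a table, so that g k computes for a numeral k but stays a small stuck
-- term for a variable k.
tabulated : ∀ {A : Set} {n} → (Fin n → A) → Fin n → A
tabulated g = Vec.lookup (Vec.tabulate g)

ports : Fin 31 → List Port
ports = tabulated (λ k → map proj₂ (filter (λ p → proj₁ p Fin.≟ k) portTable))

isFamily : Port → ℕ
isFamily (inTail _)  = 1
isFamily (outHead _) = 1
isFamily _           = 0

families : List Port → ℕ
families []       = 0
families (p ∷ ps) = isFamily p + families ps

P-degrees : All (λ k → length (PNbrs k) + length (ports k) ≤ 4 × families (ports k) ≤ 1) (allFin 31)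
P-degrees = toWitness {a? = all? (λ k →
  (length (PNbrs k) + length (ports k) ℕ.≤? 4) ×-dec (families (ports k) ℕ.≤? 1)) (allFin 31)} _

module NeighbourLists {ℰ : Graph} {d : ℕ} (regular : Regular d ℰ) where

  nbrList : V ℰ → List (V ℰ)
  nbrList v = proj₁ (regular v)

  length-nbrList : ∀ v → length (nbrList v) ≡ d
  length-nbrList v = proj₁ (proj₂ (proj₂ (regular v)))

  ∈nbrList⇔ : ∀ v w → Adj ℰ v w ⇔ w ∈ nbrList v
  ∈nbrList⇔ v w = proj₂ (proj₂ (proj₂ (regular v))) w

module Neighbourhoods (ℰ : Graph) (adj-prop : AdjProp ℰ) {d : ℕ} (regular : Regular d ℰ)
                      {m : ℕ} (f : Arc ℰ ↔ Fin m) where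

  arcAt : Fin m → Arc ℰ
  arcAt = Inverse.from f

  prevArc nextArc : Arc ℰ → Arc ℰ
  prevArc e = arcAt (prev (Inverse.to f e))
  nextArc e = arcAt (next (Inverse.to f e))

  open NeighbourLists {ℰ} regular

  outArcs inArcs : V ℰ → List (Arc ℰ)
  outArcs v = mapWith∈ (nbrList v) (λ {w} w∈ → (v , w) , Equivalence.from (∈nbrList⇔ v w) w∈)
  inArcs  v = mapWith∈ (nbrList v) (λ {w} w∈ → (w , v) , Adj-sym ℰ (Equivalence.from (∈nbrList⇔ v w) w∈))

  length-outArcs : ∀ v → length (outArcs v) ≡ d
  length-outArcs v = trans (Membershipₚ.length-mapWith∈ (setoid _) (nbrList v)) (length-nbrList v)

  length-inArcs : ∀ v → length (inArcs v) ≡ d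
  length-inArcs v = trans (Membershipₚ.length-mapWith∈ (setoid _) (nbrList v)) (length-nbrList v)

  ∈-outArcs : ∀ e {v} → tail ℰ e ≡ v → e ∈ outArcs v
  ∈-outArcs ((u , w) , uw) refl = subst (λ uw' → ((u , w) , uw') ∈ outArcs u) (adj-prop _ uw)
    (∈-mapWith∈ (nbrList u) _ (Equivalence.to (∈nbrList⇔ u w) uw))

  ∈-inArcs : ∀ e {v} → head ℰ e ≡ v → e ∈ inArcs v
  ∈-inArcs ((u , w) , uw) refl = subst (λ uw' → ((u , w) , uw') ∈ inArcs w) (adj-prop _ uw)
    (∈-mapWith∈ (nbrList w) _ (Equivalence.to (∈nbrList⇔ w u) (Adj-sym ℰ uw)))

  ⟦_⟧ : Port → Arc ℰ → List (GV ℰ)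
  ⟦ prevCycle ⟧ e = a ℰ (prevArc e) 31 ∷ []
  ⟦ nextCycle ⟧ e = a ℰ (nextArc e) 1 ∷ []
  ⟦ inTail c  ⟧ e = map (λ e' → inj₁ (e' , c)) (inArcs (tail ℰ e))
  ⟦ outHead c ⟧ e = map (λ e' → inj₁ (e' , c)) (outArcs (head ℰ e))
  ⟦ tailHub c ⟧ e = inj₂ (tail ℰ e , c) ∷ []
  ⟦ headHub c ⟧ e = inj₂ (head ℰ e , c) ∷ []

  ⟦_⟧* : List Port → Arc ℰ → List (GV ℰ)
  ⟦ [] ⟧*     e = []
  ⟦ p ∷ ps ⟧* e = ⟦ p ⟧ e ++ ⟦ ps ⟧* e

  hubNbrs : V ℰ → Fin 6 → List (GV ℰ)
  hubNbrs v 0F = b ℰ v 2 ∷ map (λ e → a ℰ e 5) (outArcs v)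
  hubNbrs v 1F = b ℰ v 1 ∷ b ℰ v 3 ∷ []
  hubNbrs v 2F = b ℰ v 2 ∷ map (λ e → a ℰ e 23) (inArcs v)
  hubNbrs v 3F = b ℰ v 5 ∷ map (λ e → a ℰ e 24) (inArcs v)
  hubNbrs v 4F = b ℰ v 4 ∷ b ℰ v 6 ∷ []
  hubNbrs v 5F = b ℰ v 5 ∷ map (λ e → a ℰ e 12) (outArcs v)

  nbrs : GV ℰ → List (GV ℰ)
  nbrs (inj₁ (e , k)) = map (λ c → inj₁ (e , c)) (PNbrs k) ++ ⟦ ports k ⟧* e
  nbrs (inj₂ (v , k)) = hubNbrs v k

  ∈-⟦⟧* : ∀ {p ps e y} → p ∈ ps → y ∈ ⟦ p ⟧ e → y ∈ ⟦ ps ⟧* e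
  ∈-⟦⟧* {ps = p ∷ ps} (here refl) y∈ = ∈-++⁺ˡ y∈
  ∈-⟦⟧* {ps = p ∷ ps} {e} (there p∈) y∈ = ∈-++⁺ʳ (⟦ p ⟧ e) (∈-⟦⟧* p∈ y∈)

  internal : ∀ e k {j} → j ∈ PNbrs k → inj₁ (e , j) ∈ nbrs (inj₁ (e , k))
  internal e k j∈ = ∈-++⁺ˡ (∈-map⁺ _ j∈)

  external : ∀ e k {p y} → p ∈ ports k → y ∈ ⟦ p ⟧ e → y ∈ nbrs (inj₁ (e , k))
  external e k p∈ y∈ = ∈-++⁺ʳ (map (λ c → inj₁ (e , c)) (PNbrs k)) (∈-⟦⟧* p∈ y∈)

  Adj⇒∈nbrs : ∀ {x y} → GAdj ℰ f x y → y ∈ nbrs x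
  Adj⇒∈nbrs (inj₁ (pEdge e i j ij)) = internal e i (proj₁ (PEdge⇒PNbrs {i} {j} ij))
  Adj⇒∈nbrs (inj₂ (pEdge e i j ij)) = internal e j (proj₂ (PEdge⇒PNbrs {i} {j} ij))
  Adj⇒∈nbrs (inj₁ (cycEdge i)) =
    external (arcAt i) (ix 31) (here refl) (here (cong (λ j → a ℰ (arcAt (next j)) 1) (sym (Inverse.strictlyInverseˡ f i))))
  Adj⇒∈nbrs (inj₂ (cycEdge i)) =
    external (arcAt (next i)) (ix 1) (here refl) (here (cong (λ j → a ℰ (arcAt j) 31)
      (sym (trans (cong prev (Inverse.strictlyInverseˡ f (next i))) (prev-next i)))))
  Adj⇒∈nbrs (inj₁ (l1 e₁ e₂ h))  = external e₁ (ix 23) (here refl) (∈-map⁺ _ (∈-outArcs e₂ (sym h)))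
  Adj⇒∈nbrs (inj₂ (l1 e₁ e₂ h))  = external e₂ (ix 3) (here refl) (∈-map⁺ _ (∈-inArcs e₁ h))
  Adj⇒∈nbrs (inj₁ (l2 e₁ e₂ h))  = external e₁ (ix 18) (here refl) (∈-map⁺ _ (∈-outArcs e₂ (sym h)))
  Adj⇒∈nbrs (inj₂ (l2 e₁ e₂ h))  = external e₂ (ix 8) (here refl) (∈-map⁺ _ (∈-inArcs e₁ h))
  Adj⇒∈nbrs (inj₁ (l3 e₁ e₂ h))  = external e₁ (ix 29) (here refl) (∈-map⁺ _ (∈-outArcs e₂ (sym h)))
  Adj⇒∈nbrs (inj₂ (l3 e₁ e₂ h))  = external e₂ (ix 9) (here refl) (∈-map⁺ _ (∈-inArcs e₁ h))
  Adj⇒∈nbrs (inj₁ (l4 e₁ e₂ h))  = external e₁ (ix 24) (here refl) (∈-map⁺ _ (∈-outArcs e₂ (sym h)))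
  Adj⇒∈nbrs (inj₂ (l4 e₁ e₂ h))  = external e₂ (ix 14) (here refl) (∈-map⁺ _ (∈-inArcs e₁ h))
  Adj⇒∈nbrs (inj₁ (l5 e₁ e₂ h))  = external e₂ (ix 5) (here refl) (here (cong (λ v → b ℰ v 1) h))
  Adj⇒∈nbrs (inj₂ (l5 e₁ e₂ h))  = there (∈-map⁺ _ (∈-outArcs e₂ (sym h)))
  Adj⇒∈nbrs (inj₁ (l6 e₁ e₂ h))  = here refl
  Adj⇒∈nbrs (inj₂ (l6 e₁ e₂ h))  = here refl
  Adj⇒∈nbrs (inj₁ (l7 e₁ e₂ h))  = there (here refl)
  Adj⇒∈nbrs (inj₂ (l7 e₁ e₂ h))  = here refl
  Adj⇒∈nbrs (inj₁ (l8 e₁ e₂ h))  = there (∈-map⁺ _ (∈-inArcs e₁ refl))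
  Adj⇒∈nbrs (inj₂ (l8 e₁ e₂ h))  = external e₁ (ix 23) (there (here refl)) (here refl)
  Adj⇒∈nbrs (inj₁ (l9 e₁ e₂ h))  = external e₁ (ix 24) (there (here refl)) (here refl)
  Adj⇒∈nbrs (inj₂ (l9 e₁ e₂ h))  = there (∈-map⁺ _ (∈-inArcs e₁ refl))
  Adj⇒∈nbrs (inj₁ (l10 e₁ e₂ h)) = here refl
  Adj⇒∈nbrs (inj₂ (l10 e₁ e₂ h)) = here refl
  Adj⇒∈nbrs (inj₁ (l11 e₁ e₂ h)) = there (here refl)
  Adj⇒∈nbrs (inj₂ (l11 e₁ e₂ h)) = here refl
  Adj⇒∈nbrs (inj₁ (l12 e₁ e₂ h)) = there (∈-map⁺ _ (∈-outArcs e₂ (sym h)))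
  Adj⇒∈nbrs (inj₂ (l12 e₁ e₂ h)) = external e₂ (ix 12) (here refl) (here (cong (λ v → b ℰ v 6) h))

  module _ {d′ : ℕ} (d≡1+d′ : d ≡ suc d′) where

    length-⟦⟧ : ∀ p e → length (⟦ p ⟧ e) ≡ 1 + isFamily p * d′
    length-⟦⟧ prevCycle   e = refl
    length-⟦⟧ nextCycle   e = refl
    length-⟦⟧ (inTail c)  e = trans (length-map _ (inArcs (tail ℰ e)))
      (trans (length-inArcs _) (trans d≡1+d′ (cong suc (sym (+-identityʳ d′)))))
    length-⟦⟧ (outHead c) e = trans (length-map _ (outArcs (head ℰ e)))
      (trans (length-outArcs _) (trans d≡1+d′ (cong suc (sym (+-identityʳ d′)))))
    length-⟦⟧ (tailHub c) e = refl
    length-⟦⟧ (headHub c) e = refl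

    length-⟦⟧* : ∀ ps e → length (⟦ ps ⟧* e) ≡ length ps + families ps * d′
    length-⟦⟧* []       e = refl
    length-⟦⟧* (p ∷ ps) e = begin
      length (⟦ p ⟧ e ++ ⟦ ps ⟧* e)                          ≡⟨ length-++ (⟦ p ⟧ e) ⟩
      length (⟦ p ⟧ e) + length (⟦ ps ⟧* e)                  ≡⟨ cong₂ _+_ (length-⟦⟧ p e) (length-⟦⟧* ps e) ⟩
      (1 + isFamily p * d′) + (length ps + families ps * d′) ≡⟨ regroup (isFamily p) (length ps) (families ps) d′ ⟩
      suc (length ps) + (isFamily p + families ps) * d′      ∎
      where
      open ≡-Reasoning
      regroup : ∀ i l f x → (1 + i * x) + (l + f * x) ≡ suc l + (i + f) * x
      regroup = solve 4 (λ i l f x → (con 1 :+ i :* x) :+ (l :+ f :* x) := (con 1 :+ l) :+ (i :+ f) :* x) refl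

    degree-a : ∀ e k → length (nbrs (inj₁ (e , k))) ≤ d + 3
    degree-a e k with All.lookup P-degrees (∈-allFin k)
    ... | small , few = begin
      length (map (λ c → inj₁ (e , c)) (PNbrs k) ++ ⟦ ports k ⟧* e)
        ≡⟨ length-++ (map (λ c → inj₁ (e , c)) (PNbrs k)) ⟩
      length (map (λ c → inj₁ (e , c)) (PNbrs k)) + length (⟦ ports k ⟧* e)
        ≡⟨ cong₂ _+_ (length-map _ (PNbrs k)) (length-⟦⟧* (ports k) e) ⟩
      length (PNbrs k) + (length (ports k) + families (ports k) * d′)
        ≡⟨ sym (+-assoc (length (PNbrs k)) _ _) ⟩
      length (PNbrs k) + length (ports k) + families (ports k) * d′
        ≤⟨ +-mono-≤ small (*-monoˡ-≤ d′ few) ⟩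
      4 + (d′ + 0)
        ≡⟨ rearrange d′ ⟩
      suc d′ + 3
        ≡⟨ cong (_+ 3) (sym d≡1+d′) ⟩
      d + 3 ∎
      where
      open ≤-Reasoning
      rearrange : ∀ x → 4 + (x + 0) ≡ suc x + 3
      rearrange = solve 1 (λ x → con 4 :+ (x :+ con 0) := (con 1 :+ x) :+ con 3) refl

  private
    1+arcs≤ : ∀ (g : Arc ℰ → GV ℰ) es → length es ≡ d → suc (length (map g es)) ≤ d + 3
    1+arcs≤ g es |es|≡d = begin
      suc (length (map g es)) ≡⟨ cong suc (trans (length-map g es) |es|≡d) ⟩
      suc d                   ≤⟨ m≤n+m (suc d) 2 ⟩
      2 + suc d               ≡⟨ +-comm 2 (suc d) ⟩
      suc d + 2               ≡⟨ sym (+-suc d 2) ⟩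
      d + 3                   ∎
      where open ≤-Reasoning

    2≤ : 2 ≤ d + 3
    2≤ = ≤-trans (m≤n+m 2 1) (m≤n+m 3 d)

  degree-b : ∀ v k → length (hubNbrs v k) ≤ d + 3
  degree-b v 0F = 1+arcs≤ (λ e → a ℰ e 5) (outArcs v) (length-outArcs v)
  degree-b v 1F = 2≤
  degree-b v 2F = 1+arcs≤ (λ e → a ℰ e 23) (inArcs v) (length-inArcs v)
  degree-b v 3F = 1+arcs≤ (λ e → a ℰ e 24) (inArcs v) (length-inArcs v)
  degree-b v 4F = 2≤
  degree-b v 5F = 1+arcs≤ (λ e → a ℰ e 12) (outArcs v) (length-outArcs v)

  maxDegree : 1 ≤ d → MaxDegree≤ (d + 3) G[ ℰ , f ]
  maxDegree 1≤d x = nbrs x , degree x , λ _ → Adj⇒∈nbrs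
    where
    degree : ∀ x → length (nbrs x) ≤ d + 3
    degree (inj₁ (e , k)) = degree-a (sym (m+[n∸m]≡n 1≤d)) e k
    degree (inj₂ (v , k)) = degree-b v k

-- Counting cycle edges through the gadgets

+≡1 : ∀ x y → x + y ≡ 1 → (x ≡ 0 × y ≡ 1) ⊎ (x ≡ 1 × y ≡ 0)
+≡1 zero          y    refl = inj₁ (refl , refl)
+≡1 (suc zero)    zero refl = inj₂ (refl , refl)

both-1 : ∀ {p q} → p ≤ 1 → q ≤ 1 → p + (q + 0) ≡ 2 → p ≡ 1 × q ≡ 1
both-1 {suc zero}    {suc zero}    _       _       _  = refl , refl
both-1 {zero}        {suc (suc _)} _       (s≤s ()) _
both-1 {suc (suc _)} {_}           (s≤s ()) _      _
both-1 {suc zero}    {suc (suc _)} _       (s≤s ()) _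

drop-first : ∀ {p q} → p ≡ 1 → p + q ≡ 2 → q ≡ 1
drop-first refl = suc-injective

drop-middle : ∀ p {q r} → q ≡ 1 → p + (q + r) ≡ 2 → p + r ≡ 1
drop-middle p {r = r} refl eq = suc-injective (trans (sym (+-suc p r)) eq)

drop-middle₀ : ∀ p {q r} → q ≡ 1 → p + (q + (r + 0)) ≡ 2 → p + r ≡ 1
drop-middle₀ p {r = r} q≡1 eq = trans (cong (p +_) (sym (+-identityʳ r))) (drop-middle p q≡1 eq)

-- The local count at P(e): cX-Y indicates the cycle edge a^e_X a^e_Y, and hub, in8, in14, out18 count
-- the cycle edges leaving P(e) at a^e_12, a^e_8, a^e_14, a^e_18.  Whether or not the cycle uses
-- a^e_14 a^e_15, the three excluded hexagons then pin down every indicator.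
gadget-inequalities : ∀ {c6-11 c11-12 c14-15 c15-20 c12-17 c17-18 c8-9 hub in8 in14 out18} →
  c6-11 + c11-12 ≡ 1 → c14-15 + c15-20 ≡ 1 → c12-17 + c17-18 ≡ 1 → c11-12 + (c12-17 + hub) ≡ 1 →
  c8-9 + in8 ≡ 1 → c14-15 + in14 ≡ 1 → c17-18 + out18 ≡ 1 →
  ¬ (c8-9 ≡ 1 × c6-11 ≡ 1) → ¬ (c14-15 ≡ 1 × c12-17 ≡ 1) → ¬ (c17-18 ≡ 1 × c15-20 ≡ 1) →
  hub + in14 ≤ in8 × out18 ≤ in14
gadget-inequalities {c6-11} {c11-12} {c14-15} {c15-20} {c12-17} {c17-18} {c8-9} {hub} {in8} {in14} {out18}
                    v11 v15 v17 v12 v8 v14 v18 hex₁ hex₂ hex₃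
  with +≡1 c14-15 in14 v14 | +≡1 c12-17 c17-18 v17 | +≡1 c6-11 c11-12 v11 | +≡1 c8-9 in8 v8
... | inj₂ (refl , refl) | inj₂ (refl , refl) | _ | _ = ⊥-elim (hex₂ (refl , refl))
... | inj₁ (refl , refl) | inj₁ (refl , refl) | _ | _ with refl ← v15 = ⊥-elim (hex₃ (refl , refl))
... | _ | _ | inj₂ (refl , refl) | inj₂ (refl , refl) = ⊥-elim (hex₁ (refl , refl))
... | inj₂ (refl , refl) | inj₁ (refl , refl) | inj₂ (refl , refl) | inj₁ (refl , refl)
  with refl ← v18 | refl ← v12 = ≤-refl , z≤n
... | inj₂ (refl , refl) | inj₁ (refl , refl) | inj₁ (refl , refl) | _
  with refl ← v18 | refl ← v12 = z≤n , z≤n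
... | inj₁ (refl , refl) | inj₂ (refl , refl) | inj₂ (refl , refl) | inj₁ (refl , refl)
  with refl ← v18 | refl ← v12 = ≤-refl , ≤-refl
... | inj₁ (refl , refl) | inj₂ (refl , refl) | inj₁ (refl , refl) | _ with () ← v12

1≤-complement : ∀ {p q} → p ≤ 1 → p + q ≡ 2 → 1 ≤ q
1≤-complement {zero}        _        refl = s≤s z≤n
1≤-complement {suc zero}    _        refl = ≤-refl
1≤-complement {suc (suc _)} (s≤s ()) _

module GadgetCounting (ℰ : Graph) (adj-prop : AdjProp ℰ) {d : ℕ} (regular : Regular d ℰ)
  {m : ℕ} (f : Arc ℰ ↔ Fin m) (E : List (GV ℰ × GV ℰ))
  (σ : Fin (size G[ ℰ , f ]) → GV ℰ) (σ-bijective : Bijective _≡_ _≡_ σ)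
  (σ-adj : ∀ i → Toggle G[ ℰ , f ] E (σ i) (σ (next i))) (3≤n : 3 ≤ size G[ ℰ , f ]) where

  _≟_ : DecidableEquality (GV ℰ)
  _≟_ = ⊎ₚ.≡-dec (Σₚ.≡-dec (≟-via-↔ f) Fin._≟_) (Σₚ.≡-dec (≟-via-↔ (enum ℰ)) Fin._≟_)

  open Neighbourhoods ℰ adj-prop regular f
  open EditedHamiltonianCycle G[ ℰ , f ] _≟_ E σ σ-bijective σ-adj 3≤n
  open Count _≟_

  vertexAt : Fin (size ℰ) → V ℰ
  vertexAt = Inverse.from (enum ℰ)

  level : Fin 31 → Fin m → GV ℰ
  level c i = inj₁ (arcAt i , c)

  hubs : Fin (size ℰ) → GV ℰ
  hubs j = b ℰ (vertexAt j) 6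

  level-injective : ∀ c → Injective _≡_ _≡_ (level c)
  level-injective c = from-injective f ∘ cong proj₁ ∘ ⊎ₚ.inj₁-injective

  hubs-injective : Injective _≡_ _≡_ hubs
  hubs-injective = from-injective (enum ℰ) ∘ cong proj₁ ∘ ⊎ₚ.inj₂-injective

  level-covers : ∀ c es {y} → y ∈ map (λ e' → inj₁ (e' , c)) es ++ List.[] → ∃ λ i → level c i ≡ y
  level-covers c es y∈ with ∈-++⁻ (map (λ e' → inj₁ (e' , c)) es) y∈
  ... | inj₁ y∈es with ∈-map⁻ _ y∈es
  ...   | e' , _ , refl = Inverse.to f e' , cong (λ e″ → inj₁ (e″ , c)) (Inverse.strictlyInverseʳ f e')
  level-covers c es y∈ | inj₂ ()

  hubs-covers : ∀ v {y} → y ∈ b ℰ v 6 List.∷ List.[] → ∃ λ j → hubs j ≡ y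
  hubs-covers v (here refl) = Inverse.to (enum ℰ) v , cong (λ w → b ℰ w 6) (Inverse.strictlyInverseʳ (enum ℰ) v)

  inP : ∀ {k} → Arc ℰ → (L : List (Fin 31)) → Vector (GV ℰ) k → Vector (GV ℰ) (length L + k)
  inP e List.[]       h = h
  inP e (c List.∷ L) h = inj₁ (e , c) ∷ᵥ inP e L h

  inP-internal : ∀ {k} e {L} (h : Vector (GV ℰ) k) {c} → c ∈ L → ∃ λ i → inP e L h i ≡ inj₁ (e , c)
  inP-internal e h (here refl) = Fin.zero , refl
  inP-internal e h (there c∈L) with inP-internal e h c∈L
  ... | i , eq = Fin.suc i , eq

  inP-external : ∀ {k} e L (h : Vector (GV ℰ) k) j → ∃ λ i → inP e L h i ≡ h j
  inP-external e List.[]       h j = j , refl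
  inP-external e (c List.∷ L) h j with inP-external e L h j
  ... | i , eq = Fin.suc i , eq

  inP-fresh : ∀ {k} e {L} (h : Vector (GV ℰ) k) {c} → c ∉ L → (∀ j → h j ≢ inj₁ (e , c)) →
    ∀ i → inP e L h i ≢ inj₁ (e , c)
  inP-fresh e {List.[]}     h c∉L fresh i = fresh i
  inP-fresh e {_ List.∷ L} h c∉L fresh Fin.zero eq = c∉L (here (sym (cong proj₂ (⊎ₚ.inj₁-injective eq))))
  inP-fresh e {_ List.∷ L} h c∉L fresh (Fin.suc i) = inP-fresh e h (c∉L ∘ there) fresh i

  inP-injective : ∀ {k} e {L} (h : Vector (GV ℰ) k) → Unique L → Injective _≡_ _≡_ h →
    (∀ j {c} → c ∈ L → h j ≢ inj₁ (e , c)) → Injective _≡_ _≡_ (inP e L h)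
  inP-injective e {List.[]}     h _ h-inj _ = h-inj
  inP-injective e {c List.∷ L} h (c∉L AllPairs.∷ L-unique) h-inj avoid =
    ∷-injective (inP-fresh e h (All¬⇒¬Any c∉L) (λ j → avoid j (here refl)))
                (inP-injective e h L-unique h-inj (λ j → avoid j ∘ there))

  cycleDegree-inP : ∀ e k {r} (h : Vector (GV ℰ) r) → touches (inj₁ (e , k)) ≡ 0 → Injective _≡_ _≡_ h →
    (∀ j {c} → c ∈ PNbrs k → h j ≢ inj₁ (e , c)) → (∀ {y} → y ∈ ⟦ ports k ⟧* e → ∃ λ j → h j ≡ y) →
    cycleDegree (inj₁ (e , k)) (inP e (PNbrs k) h) ≡ 2
  cycleDegree-inP e k h untouched h-inj avoid covers =
    cycleDegree-untouched _ _ untouched (inP-injective e h (All.lookup PNbrs-unique (∈-allFin k)) h-inj avoid) cover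
    where
    cover : ∀ {z} → GAdj ℰ f (inj₁ (e , k)) z → ∃ λ i → inP e (PNbrs k) h i ≡ z
    cover adj with ∈-++⁻ (map (λ c → inj₁ (e , c)) (PNbrs k)) (Adj⇒∈nbrs adj)
    ... | inj₁ z∈P with ∈-map⁻ _ z∈P
    ...   | c , c∈ , refl = inP-internal e h c∈
    cover adj | inj₂ z∈ext with covers z∈ext
    ...   | j , refl = inP-external e (PNbrs k) h j

  infix 7 _─_
  _─_ : GV ℰ → GV ℰ → ℕ
  _─_ = cycleEdge

  level-avoids : ∀ {e} c k → {True (c ∉? PNbrs k)} → ∀ j {c'} → c' ∈ PNbrs k → level c j ≢ inj₁ (e , c')
  level-avoids c k {c∉} j c'∈ eq = toWitness c∉ (subst (_∈ PNbrs k) (sym (cong proj₂ (⊎ₚ.inj₁-injective eq))) c'∈)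

  in8 in14 out18 toHub : Arc ℰ → ℕ
  in8   e = cycleDegree (a ℰ e 8) (level (ix 18))
  in14  e = cycleDegree (a ℰ e 14) (level (ix 24))
  out18 e = cycleDegree (a ℰ e 18) (level (ix 8))
  toHub e = cycleDegree (a ℰ e 12) hubs

  n>6 : Arc ℰ → size G[ ℰ , f ] > 6
  n>6 e = ≤-trans (m≤m+n 7 24) (≤-trans (*-monoˡ-≤ 31 1≤m) (m≤m+n (m * 31) (size ℰ * 6)))
    where 1≤m : 1 ≤ m
          1≤m = ≤-trans (s≤s z≤n) (Data.Fin.Properties.toℕ<n (Inverse.to f e))

  module UntouchedGadget (e : Arc ℰ) (untouched : ∀ k → touches (inj₁ (e , k)) ≡ 0) where

    x : (n : ℕ) → {True ((n ∸ 1) ℕ.<? 31)} → GV ℰ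
    x = a ℰ e

    deg7 : x 7 ─ x 6 + (x 7 ─ x 8 + 0) ≡ 2
    deg7 = cycleDegree-inP e (ix 7) []ᵥ (untouched _) []-injective (λ ()) (λ ())
    deg10 : x 10 ─ x 9 + (x 10 ─ x 11 + 0) ≡ 2
    deg10 = cycleDegree-inP e (ix 10) []ᵥ (untouched _) []-injective (λ ()) (λ ())
    deg13 : x 13 ─ x 12 + (x 13 ─ x 14 + 0) ≡ 2
    deg13 = cycleDegree-inP e (ix 13) []ᵥ (untouched _) []-injective (λ ()) (λ ())
    deg16 : x 16 ─ x 15 + (x 16 ─ x 17 + 0) ≡ 2
    deg16 = cycleDegree-inP e (ix 16) []ᵥ (untouched _) []-injective (λ ()) (λ ())
    deg19 : x 19 ─ x 18 + (x 19 ─ x 20 + 0) ≡ 2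
    deg19 = cycleDegree-inP e (ix 19) []ᵥ (untouched _) []-injective (λ ()) (λ ())

    deg11 : x 11 ─ x 6 + (x 11 ─ x 10 + (x 11 ─ x 12 + 0)) ≡ 2
    deg11 = cycleDegree-inP e (ix 11) []ᵥ (untouched _) []-injective (λ ()) (λ ())
    deg15 : x 15 ─ x 14 + (x 15 ─ x 16 + (x 15 ─ x 20 + 0)) ≡ 2
    deg15 = cycleDegree-inP e (ix 15) []ᵥ (untouched _) []-injective (λ ()) (λ ())
    deg17 : x 17 ─ x 12 + (x 17 ─ x 16 + (x 17 ─ x 18 + 0)) ≡ 2
    deg17 = cycleDegree-inP e (ix 17) []ᵥ (untouched _) []-injective (λ ()) (λ ())

    deg8 : x 8 ─ x 7 + (x 8 ─ x 9 + in8 e) ≡ 2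
    deg8 = cycleDegree-inP e (ix 8) (level (ix 18)) (untouched _) (level-injective _)
            (level-avoids (ix 18) (ix 8)) (level-covers (ix 18) _)
    deg14 : x 14 ─ x 13 + (x 14 ─ x 15 + in14 e) ≡ 2
    deg14 = cycleDegree-inP e (ix 14) (level (ix 24)) (untouched _) (level-injective _)
            (level-avoids (ix 24) (ix 14)) (level-covers (ix 24) _)
    deg18 : x 18 ─ x 17 + (x 18 ─ x 19 + out18 e) ≡ 2
    deg18 = cycleDegree-inP e (ix 18) (level (ix 8)) (untouched _) (level-injective _)
            (level-avoids (ix 8) (ix 18)) (level-covers (ix 8) _)
    deg12 : x 12 ─ x 11 + (x 12 ─ x 13 + (x 12 ─ x 17 + toHub e)) ≡ 2
    deg12 = cycleDegree-inP e (ix 12) hubs (untouched _) hubs-injective (λ _ _ ()) (hubs-covers (tail ℰ e))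

    flip : ∀ {y z} → y ─ z ≡ 1 → z ─ y ≡ 1
    flip {y} {z} yz = trans (cycleEdge-sym z y) yz

    flip-first : ∀ {y z s} → y ─ z + s ≡ 1 → z ─ y + s ≡ 1
    flip-first {y} {z} {s} eq = trans (cong (_+ s) (cycleEdge-sym z y)) eq

    forced : ∀ {y z w} → y ─ z + (y ─ w + 0) ≡ 2 → y ─ z ≡ 1 × y ─ w ≡ 1
    forced {y} {z} {w} = both-1 (cycleEdge-≤1 y z) (cycleEdge-≤1 y w)

    forced7 : x 7 ─ x 6 ≡ 1 × x 7 ─ x 8 ≡ 1
    forced7 = forced deg7
    forced10 : x 10 ─ x 9 ≡ 1 × x 10 ─ x 11 ≡ 1
    forced10 = forced deg10
    forced13 : x 13 ─ x 12 ≡ 1 × x 13 ─ x 14 ≡ 1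
    forced13 = forced deg13
    forced16 : x 16 ─ x 15 ≡ 1 × x 16 ─ x 17 ≡ 1
    forced16 = forced deg16
    forced19 : x 19 ─ x 18 ≡ 1 × x 19 ─ x 20 ≡ 1
    forced19 = forced deg19

    no-hexagon₁ : ¬ (x 8 ─ x 9 ≡ 1 × x 11 ─ x 6 ≡ 1)
    no-hexagon₁ (c8-9 , c11-6) = no-hexagon (n>6 e) {x 6} {x 7} {x 8} {x 9} {x 10} {x 11}
      (flip (proj₁ forced7)) (proj₂ forced7) c8-9 (flip (proj₁ forced10)) (proj₂ forced10) c11-6
      (λ ()) (λ ()) (λ ()) (λ ()) (λ ()) (λ ())

    no-hexagon₂ : ¬ (x 14 ─ x 15 ≡ 1 × x 12 ─ x 17 ≡ 1)
    no-hexagon₂ (c14-15 , c12-17) = no-hexagon (n>6 e) {x 12} {x 13} {x 14} {x 15} {x 16} {x 17}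
      (flip (proj₁ forced13)) (proj₂ forced13) c14-15 (flip (proj₁ forced16)) (proj₂ forced16) (flip c12-17)
      (λ ()) (λ ()) (λ ()) (λ ()) (λ ()) (λ ())

    no-hexagon₃ : ¬ (x 17 ─ x 18 ≡ 1 × x 15 ─ x 20 ≡ 1)
    no-hexagon₃ (c17-18 , c15-20) = no-hexagon (n>6 e) {x 15} {x 16} {x 17} {x 18} {x 19} {x 20}
      (flip (proj₁ forced16)) (proj₂ forced16) c17-18 (flip (proj₁ forced19)) (proj₂ forced19) (flip c15-20)
      (λ ()) (λ ()) (λ ()) (λ ()) (λ ()) (λ ())

    inequalities : toHub e + in14 e ≤ in8 e × out18 e ≤ in14 e
    inequalities = gadget-inequalities v11 v15 v17 v12 v8 v14 v18 no-hexagon₁ no-hexagon₂ no-hexagon₃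
      where
      v11 : x 11 ─ x 6 + x 11 ─ x 12 ≡ 1
      v11 = drop-middle₀ (x 11 ─ x 6) (flip (proj₂ forced10)) deg11
      v15 : x 14 ─ x 15 + x 15 ─ x 20 ≡ 1
      v15 = flip-first (drop-middle₀ (x 15 ─ x 14) (flip (proj₁ forced16)) deg15)
      v17 : x 12 ─ x 17 + x 17 ─ x 18 ≡ 1
      v17 = flip-first (drop-middle₀ (x 17 ─ x 12) (flip (proj₂ forced16)) deg17)
      v12 : x 11 ─ x 12 + (x 12 ─ x 17 + toHub e) ≡ 1
      v12 = flip-first (drop-middle (x 12 ─ x 11) (flip (proj₁ forced13)) deg12)
      v8 : x 8 ─ x 9 + in8 e ≡ 1
      v8 = drop-first (flip (proj₂ forced7)) deg8
      v14 : x 14 ─ x 15 + in14 e ≡ 1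
      v14 = drop-first (flip (proj₂ forced13)) deg14
      v18 : x 17 ─ x 18 + out18 e ≡ 1
      v18 = flip-first (drop-middle (x 18 ─ x 17) (flip (proj₁ forced19)) deg18)

  T : Arc ℰ → ℕ
  T e = sum (λ k → touches (inj₁ (e , k)))

  gadget-bounds : ∀ e → toHub e + in14 e ≤ in8 e + 4 * T e × out18 e ≤ in14 e + 2 * T e
  gadget-bounds e = by-cases (T e ℕ.≟ 0)
    where
    by-cases : Dec (T e ≡ 0) → toHub e + in14 e ≤ in8 e + 4 * T e × out18 e ≤ in14 e + 2 * T e
    by-cases (yes T≡0) = ≤-trans (proj₁ ineq) (m≤m+n (in8 e) (4 * T e)) , ≤-trans (proj₂ ineq) (m≤m+n (in14 e) (2 * T e))
      where ineq : toHub e + in14 e ≤ in8 e × out18 e ≤ in14 e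
            ineq = UntouchedGadget.inequalities e (sum≡0⇒≡0 (λ k → touches (inj₁ (e , k))) T≡0)
    by-cases (no T≢0) = ≤-trans (+-mono-≤ (cycleDegree-≤2 (a ℰ e 12) hubs hubs-injective)
                                          (cycleDegree-≤2 (a ℰ e 14) (level (ix 24)) (level-injective (ix 24))))
                                (≤-trans (*-monoʳ-≤ 4 1≤T) (m≤n+m (4 * T e) (in8 e)))
                      , ≤-trans (cycleDegree-≤2 (a ℰ e 18) (level (ix 8)) (level-injective (ix 8)))
                                (≤-trans (*-monoʳ-≤ 2 1≤T) (m≤n+m (2 * T e) (in14 e)))
      where 1≤T : 1 ≤ T e
            1≤T = n≢0⇒n>0 {T e} T≢0

  ∑arcs : (Arc ℰ → ℕ) → ℕ
  ∑arcs g = sum (g ∘ arcAt)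

  ∑in8≡∑out18 : ∑arcs in8 ≡ ∑arcs out18
  ∑in8≡∑out18 = trans (∑-comm (λ i j → level (ix 8) i ─ level (ix 18) j))
                      (sum-cong-≗ {m} (λ j → sum-cong-≗ {m} (λ i → cycleEdge-sym (level (ix 8) i) (level (ix 18) j))))

  ∑toHub≤ : ∑arcs toHub ≤ 6 * ∑arcs T
  ∑toHub≤ = +-cancelʳ-≤ (∑arcs in14) _ _ (begin
    ∑arcs toHub + ∑arcs in14          ≡⟨ ∑-distrib-+ (toHub ∘ arcAt) (in14 ∘ arcAt) ⟨
    sum (λ i → toHub (arcAt i) + in14 (arcAt i))
                                      ≤⟨ sum-mono-≤ {m} (proj₁ ∘ gadget-bounds ∘ arcAt) ⟩
    sum (λ i → in8 (arcAt i) + 4 * T (arcAt i))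
                                      ≡⟨ ∑-distrib-+ (in8 ∘ arcAt) (λ i → 4 * T (arcAt i)) ⟩
    ∑arcs in8 + sum (λ i → 4 * T (arcAt i))
                                      ≡⟨ cong₂ _+_ ∑in8≡∑out18 (sym (*-distribˡ-sum 4 (T ∘ arcAt))) ⟩
    ∑arcs out18 + 4 * ∑arcs T         ≤⟨ +-monoˡ-≤ (4 * ∑arcs T) ∑out18≤ ⟩
    ∑arcs in14 + 2 * ∑arcs T + 4 * ∑arcs T
                                      ≡⟨ regroup (∑arcs in14) (∑arcs T) ⟩
    6 * ∑arcs T + ∑arcs in14          ∎)
    where
    open ≤-Reasoning
    ∑out18≤ : ∑arcs out18 ≤ ∑arcs in14 + 2 * ∑arcs T
    ∑out18≤ = begin
      ∑arcs out18                                 ≤⟨ sum-mono-≤ {m} (proj₂ ∘ gadget-bounds ∘ arcAt) ⟩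
      sum (λ i → in14 (arcAt i) + 2 * T (arcAt i)) ≡⟨ ∑-distrib-+ (in14 ∘ arcAt) (λ i → 2 * T (arcAt i)) ⟩
      ∑arcs in14 + sum (λ i → 2 * T (arcAt i))    ≡⟨ cong (∑arcs in14 +_) (sym (*-distribˡ-sum 2 (T ∘ arcAt))) ⟩
      ∑arcs in14 + 2 * ∑arcs T                    ∎
    regroup : ∀ x t → x + 2 * t + 4 * t ≡ 6 * t + x
    regroup = solve 2 (λ x t → x :+ con 2 :* t :+ con 4 :* t := con 6 :* t :+ x) refl

  ∑T≤ : ∑arcs T ≤ 2 * length E
  ∑T≤ = ∑∑-touches-≤ (λ i k → inj₁ (arcAt i , k)) once
    where
    module CountArcs = Count (≟-via-↔ f)
    row : ∀ i e c → count (λ k → inj₁ (arcAt i , k)) (inj₁ (e , c)) ≤ 𝟙 (≟-via-↔ f (arcAt i) e)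
    row i e c = by-cases (i Fin.≟ Inverse.to f e)
      where
      by-cases : Dec (i ≡ Inverse.to f e) →
        count (λ k → inj₁ (arcAt i , k)) (inj₁ (e , c)) ≤ 𝟙 (≟-via-↔ f (arcAt i) e)
      by-cases (yes refl) = subst (count (λ k → inj₁ (arcAt i , k)) (inj₁ (e , c)) ≤_)
        (sym (𝟙-yes (≟-via-↔ f (arcAt i) e) (Inverse.strictlyInverseʳ f e)))
        (count-injective-≤1 (λ k → inj₁ (arcAt i , k)) (cong proj₂ ∘ ⊎ₚ.inj₁-injective) (inj₁ (e , c)))
      by-cases (no i≢e) = ≤-trans (≤-reflexive (count-miss (λ k → inj₁ (arcAt i , k)) (inj₁ (e , c)) arcAt-i≢e)) z≤n
        where arcAt-i≢e : ∀ k → inj₁ (arcAt i , k) ≢ inj₁ (e , c)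
              arcAt-i≢e k eq = i≢e (trans (sym (Inverse.strictlyInverseˡ f i))
                                          (cong (Inverse.to f ∘ proj₁) (⊎ₚ.inj₁-injective eq)))
    once : ∀ z → sum (λ i → count (λ k → inj₁ (arcAt i , k)) z) ≤ 1
    once (inj₁ (e , c)) = ≤-trans (sum-mono-≤ {m} (λ i → row i e c))
                                  (CountArcs.count-injective-≤1 arcAt (from-injective f) e)
    once (inj₂ y) = ≤-trans (≤-reflexive (sum-zero (λ i → count (λ k → inj₁ (arcAt i , k)) (inj₂ y))
                                                   (λ i → count-miss (λ k → inj₁ (arcAt i , k)) (inj₂ y) (λ k ())))) z≤n

  Y : V ℰ → ℕ
  Y v = cycleDegree (b ℰ v 6) (level (ix 12))

  ∑Y≡∑toHub : sum (Y ∘ vertexAt) ≡ ∑arcs toHub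
  ∑Y≡∑toHub = trans (∑-comm (λ j i → hubs j ─ level (ix 12) i))
                    (sum-cong-≗ {m} (λ i → sum-cong-≗ {size ℰ} (λ j → cycleEdge-sym (hubs j) (level (ix 12) i))))

  -- An untouched b^v_6 leaves through b^v_5 or some a^e_12.
  hub-used : ∀ v → 1 ≤ Y v + touches (b ℰ v 6)
  hub-used v with touches (b ℰ v 6) ℕ.≟ 0
  ... | no  t≢0 = ≤-trans (n≢0⇒n>0 {touches (b ℰ v 6)} t≢0) (m≤n+m (touches (b ℰ v 6)) (Y v))
  ... | yes t≡0 = ≤-trans (1≤-complement (cycleEdge-≤1 (b ℰ v 6) (b ℰ v 5)) degree) (m≤m+n (Y v) _)
    where
    cover : ∀ {z} → GAdj ℰ f (b ℰ v 6) z → ∃ λ i → (b ℰ v 5 ∷ᵥ level (ix 12)) i ≡ z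
    cover adj with Adj⇒∈nbrs adj
    ... | here refl = Fin.zero , refl
    ... | there z∈ with ∈-map⁻ _ z∈
    ...   | e , _ , refl = Fin.suc (Inverse.to f e) , cong (λ e' → a ℰ e' 12) (Inverse.strictlyInverseʳ f e)
    degree : b ℰ v 6 ─ b ℰ v 5 + Y v ≡ 2
    degree = cycleDegree-untouched (b ℰ v 6) (b ℰ v 5 ∷ᵥ level (ix 12)) t≡0
               (∷-injective (λ i ()) (level-injective _)) cover

  vertices≤ : size ℰ ≤ 14 * length E
  vertices≤ = begin
    size ℰ                                        ≡⟨ trans (sum-const (size ℰ) 1) (*-identityʳ (size ℰ)) ⟨
    sum {size ℰ} (λ _ → 1)                        ≤⟨ sum-mono-≤ {size ℰ} (hub-used ∘ vertexAt) ⟩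
    sum (λ j → Y (vertexAt j) + touches (hubs j)) ≡⟨ ∑-distrib-+ (Y ∘ vertexAt) (touches ∘ hubs) ⟩
    sum (Y ∘ vertexAt) + sum (touches ∘ hubs)
      ≤⟨ +-mono-≤ (≤-reflexive ∑Y≡∑toHub) (∑-touches-≤ hubs (count-injective-≤1 hubs hubs-injective)) ⟩
    ∑arcs toHub + 2 * length E                    ≤⟨ +-monoˡ-≤ (2 * length E) (≤-trans ∑toHub≤ (*-monoʳ-≤ 6 ∑T≤)) ⟩
    6 * (2 * length E) + 2 * length E             ≡⟨ regroup (length E) ⟩
    14 * length E                                 ∎
    where
    open ≤-Reasoning
    regroup : ∀ l → 6 * (2 * l) + 2 * l ≡ 14 * l
    regroup = solve 1 (λ l → con 6 :* (con 2 :* l) :+ con 2 :* l := con 14 :* l) refl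

module ArcCount (ℰ : Graph) (adj-prop : AdjProp ℰ) {d : ℕ} (regular : Regular d ℰ) where

  open NeighbourLists {ℰ} regular

  Adj⇒∈nbrList : ∀ {v w} → Adj ℰ v w → w ∈ nbrList v
  Adj⇒∈nbrList {v} {w} = Equivalence.to (∈nbrList⇔ v w)

  code : V ℰ → Fin (size ℰ)
  code = Inverse.to (enum ℰ)

  slot : ∀ {u w} → Adj ℰ u w → Fin d
  slot {u} uw = cast (length-nbrList u) (index (Adj⇒∈nbrList uw))

  arc-code : Arc ℰ → Fin (size ℰ * d)
  arc-code ((u , w) , uw) = combine (code u) (slot uw)

  arc-code-injective : Injective _≡_ _≡_ arc-code
  arc-code-injective {(u , w) , uw} {(u' , w') , uw'} eq
    with refl ← to-injective (enum ℰ) (Finₚ.combine-injectiveˡ (code u) (slot uw) (code u') (slot uw') eq)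
    with refl ← index-injective (Adj⇒∈nbrList uw) (Adj⇒∈nbrList uw')
                  (cast-injective (length-nbrList u) (Finₚ.combine-injectiveʳ (code u) (slot uw) (code u) (slot uw') eq))
    = cong ((u , w) ,_) (adj-prop uw uw')

  arcs≤ : ∀ {m} → Arc ℰ ↔ Fin m → m ≤ size ℰ * d
  arcs≤ f = Finₚ.injective⇒≤ (from-injective f ∘ arc-code-injective)

-- Arithmetic

1/suc : ℕ → ℚ
1/suc k = ℤ.+ 1 ℚ./ suc k

1/suc-positive : ∀ k → 0ℚ < 1/suc k
1/suc-positive k = ℚₚ.toℚᵘ-cancel-< (ℚᵘₚ.<-respʳ-≃ (ℚᵘₚ.≃-sym (ℚₚ.toℚᵘ-fromℚᵘ (mkℚᵘ (ℤ.+ 1) k)))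
                                       (*<* (ℤ.+<+ (s≤s z≤n))))

1/suc-<1 : ∀ k → 1/suc (suc k) < 1ℚ
1/suc-<1 k = ℚₚ.toℚᵘ-cancel-< (ℚᵘₚ.<-respˡ-≃ (ℚᵘₚ.≃-sym (ℚₚ.toℚᵘ-fromℚᵘ (mkℚᵘ (ℤ.+ 1) (suc k))))
                                 (*<* (ℤ.+<+ (s≤s (s≤s z≤n)))))

-- Proved in ℚᵘ, where ℕtoℚ x and 1/suc k are the literal fractions x/1 and 1/(k+1).
≤-1/suc-* : ∀ k L D n → ℕtoℚ L ℚ.≤ 1/suc k ℚ.* ℕtoℚ D ℚ.* ℕtoℚ n → L * suc k ≤ D * n
≤-1/suc-* k L D n h = unnormalised (ℚᵘₚ.≤-respˡ-≃ (as-ℚᵘ L) (ℚᵘₚ.≤-respʳ-≃ rhs (ℚₚ.toℚᵘ-mono-≤ h)))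
  where
  ⌜_⌝ : ℕ → ℚᵘ.ℚᵘ
  ⌜ x ⌝ = mkℚᵘ (ℤ.+ x) 0
  as-ℚᵘ : ∀ x → toℚᵘ (ℕtoℚ x) ℚᵘ.≃ ⌜ x ⌝
  as-ℚᵘ x = ℚₚ.toℚᵘ-fromℚᵘ ⌜ x ⌝
  rhs : toℚᵘ (1/suc k ℚ.* ℕtoℚ D ℚ.* ℕtoℚ n) ℚᵘ.≃ mkℚᵘ (ℤ.+ 1) k ℚᵘ.* ⌜ D ⌝ ℚᵘ.* ⌜ n ⌝
  rhs = ℚᵘₚ.≃-trans (ℚₚ.toℚᵘ-homo-* (1/suc k ℚ.* ℕtoℚ D) (ℕtoℚ n))
          (ℚᵘₚ.*-cong (ℚᵘₚ.≃-trans (ℚₚ.toℚᵘ-homo-* (1/suc k) (ℕtoℚ D))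
                                   (ℚᵘₚ.*-cong (ℚₚ.toℚᵘ-fromℚᵘ (mkℚᵘ (ℤ.+ 1) k)) (as-ℚᵘ D)))
                      (as-ℚᵘ n))
  unnormalised : ⌜ L ⌝ ℚᵘ.≤ mkℚᵘ (ℤ.+ 1) k ℚᵘ.* ⌜ D ⌝ ℚᵘ.* ⌜ n ⌝ → L * suc k ≤ D * n
  unnormalised (*≤* p) = subst₂ _≤_ (cong (L *_) (trans (*-identityʳ _) (*-identityʳ (suc k))))
                                    (trans (*-identityʳ _) (cong (_* n) (*-identityˡ D)))
    (ℤₚ.drop‿+≤+ (subst₂ ℤ._≤_ (sym (ℤₚ.pos-* L (suc k * 1 * 1))) numerator p))
    where
    numerator : (ℤ.+ 1 ℤ.* ℤ.+ D) ℤ.* ℤ.+ n ℤ.* ℤ.+ 1 ≡ ℤ.+ (1 * D * n * 1)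
    numerator = sym (trans (ℤₚ.pos-* (1 * D * n) 1)
                      (cong (ℤ._* ℤ.+ 1) (trans (ℤₚ.pos-* (1 * D) n) (cong (ℤ._* ℤ.+ n) (ℤₚ.pos-* 1 D)))))

few-edits-impossible : ∀ D c L N n K → K > 14 * (D * c) → L * K ≤ D * n → n ≤ N * c → N ≤ 14 * L → 3 ≤ n → ⊥
few-edits-impossible D c L N n K K>k edits n≤Nc N≤14L 3≤n = 3≰0 (≤-trans 3≤n n≤0)
  where
  open ≤-Reasoning
  3≰0 : ¬ 3 ≤ 0
  3≰0 ()
  k = 14 * (D * c)
  L+Lk≤Lk : L + L * k ≤ L * k
  L+Lk≤Lk = begin
    L + L * k   ≡⟨ *-suc L k ⟨
    L * suc k   ≤⟨ *-monoʳ-≤ L K>k ⟩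
    L * K       ≤⟨ edits ⟩
    D * n       ≤⟨ *-monoʳ-≤ D (≤-trans n≤Nc (*-monoˡ-≤ c N≤14L)) ⟩
    D * (14 * L * c) ≡⟨ regroup D c L ⟩
    L * k       ∎
    where regroup : ∀ D c L → D * (14 * L * c) ≡ L * (14 * (D * c))
          regroup = solve 3 (λ D c L → D :* (con 14 :* L :* c) := L :* (con 14 :* (D :* c))) refl
  L≡0 : L ≡ 0
  L≡0 = n≤0⇒n≡0 (+-cancelʳ-≤ (L * k) L 0 L+Lk≤Lk)
  n≤0 : n ≤ 0
  n≤0 = begin
    n           ≤⟨ n≤Nc ⟩
    N * c       ≤⟨ *-monoˡ-≤ c (≤-trans N≤14L (≤-reflexive (cong (14 *_) L≡0))) ⟩
    0           ∎

size≤ : ∀ N m d → m ≤ N * d → m * 31 + N * 6 ≤ N * (6 + 31 * d)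
size≤ N m d m≤Nd = begin
  m * 31 + N * 6        ≤⟨ +-monoˡ-≤ (N * 6) (*-monoˡ-≤ 31 m≤Nd) ⟩
  N * d * 31 + N * 6    ≡⟨ regroup N d ⟩
  N * (6 + 31 * d)      ∎
  where
  open ≤-Reasoning
  regroup : ∀ N d → N * d * 31 + N * 6 ≡ N * (6 + 31 * d)
  regroup = solve 2 (λ N d → N :* d :* con 31 :+ N :* con 6 := N :* (con 6 :+ con 31 :* d)) refl

theorem4p1 : ∀ (d : ℕ) → 2 ≤ d →
    Σ[ ε ∈ ℚ ] (0ℚ < ε × ε < 1ℚ ×
      (∀ (ℰ : Graph) → AdjProp ℰ → Regular d ℰ →
        ∀ (m : ℕ) (f : Arc ℰ ↔ Fin m) →
          MaxDegree≤ (d + 3) G[ ℰ , f ] × EpsFarFromHam ε (d + 3) G[ ℰ , f ]))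
theorem4p1 d 2≤d = 1/suc K , 1/suc-positive K , 1/suc-<1 k , λ ℰ adj-prop regular m f →
    Neighbourhoods.maxDegree ℰ adj-prop regular f (≤-trans (s≤s z≤n) 2≤d) ,
    λ { E _ edits (3≤n , σ , σ-bijective , σ-adj) →
      few-edits-impossible (d + 3) (6 + 31 * d) (length E) (size ℰ) (m * 31 + size ℰ * 6) (suc K) (s≤s (n≤1+n k))
        (≤-1/suc-* K (length E) (d + 3) _ edits)
        (size≤ (size ℰ) m d (ArcCount.arcs≤ ℰ adj-prop regular f))
        (GadgetCounting.vertices≤ ℰ adj-prop regular f E σ σ-bijective σ-adj 3≤n) 3≤n }
  where
  k = 14 * ((d + 3) * (6 + 31 * d))
  K = suc k
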